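{- Let $k\ge1$, $c\in\{0,\dots,k\}$, let $\lambda$ be a partition contained in $R=(c^{k+1-c})$, and let $\mathfrak X=\{x_1,\dots,x_n\}$ be a set of $n$ cells of $\lambda$. Suppose there are two cells $x_a=(i_a,j_a)$ and $x_b=(i_b,j_b)$ in $\mathfrak X$ with $i_a>i_b$, $j_a<j_b$, and $(i_a,j_b)\in\lambda$, and that no other cell of $\mathfrak X$ lies in the rectangle $\{(p,q): i_b\le p\le i_a,\ j_a\le q\le j_b\}$. Then $\ell(w_{\lambda\setminus\mathfrak X})<\ell(w_\lambda)-n$. In this case there is no strong strip of length $n$ from $w_\lambda$ to $w_{\lambda\setminus\mathfrak X}$ in the marked strong order graph.
   Context: Affine symmetric group $W$: bijections $w:\mathbb Z\to\mathbb Z$ with $w(m+k+1)=w(m)+k+1$ and $\sum_{m=1}^{k+1}w(m)=\sum_{m=1}^{k+1}m$; $s_r$ ($0\le r\le k$) exchanges $r+t(k+1)$ and $r+1+t(k+1)$ for all $t$; $s_a:=s_{a\bmod(k+1)}$; $\ell$ is Coxeter length; for $i\not\equiv j$ mod $k+1$, $t_{i,j}$ exchanges $i+t(k+1)$ and $j+t(k+1)$ for all $t$. Marked strong order graph: directed multigraph on $W$; for $x,y$ with $\ell(x)=\ell(y)+1$ and every pair $(i,j)$ of integers with $i\le0<j$ and $y\,t_{i,j}=x$, an edge $x\to y$ labelled $y(j)$. A strong strip of length $n$ is a path $w\xrightarrow{\ell_1}\cdots\xrightarrow{\ell_n}v$ with $\ell_1>\cdots>\ell_n$. Diagrams: cell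 $(p,q)$ in row $p$ (from top), column $q$ (from left), residue $(q-p)\bmod(k+1)$. For a set $\mathcal D$ of cells, $w_{\mathcal D}=s_{r_1}\cdots s_{r_m}$ with $r_1,\dots,r_m$ the residues read starting in the bottom row, each row right to left, rows bottom to top. $\lambda\setminus\mathfrak X$ removes the cells of $\mathfrak X$. -}

module Defs where

open import Data.Nat as ℕ using (ℕ; zero; suc; _≡ᵇ_; _≤ᵇ_)
open import Data.Integer as ℤ using (ℤ; +_; _+_; _-_)
open import Data.Integer.DivMod using (_%ℕ_)
open import Data.Bool using (Bool; true; false; if_then_else_; _∧_; _∨_; not)
open import Data.List using (List; []; _∷_; _++_; length)
open import Data.List.Membership.Propositional using (_∈_)
open import Data.List.Relation.Unary.All using (All)
open import Data.List.Relation.Unary.Unique.Propositional using (Unique)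
open import Data.Product using (Σ; ∃; _×_; _,_; proj₁; proj₂)
open import Data.Fin using (Fin; inject₁; fromℕ) renaming (suc to fsuc; zero to fzero; _<_ to _<ᶠ_)
open import Relation.Binary.PropositionalEquality using (_≡_; _≢_)
open import Relation.Nullary using (¬_)

-- Throughout, k is the parameter: W is the affine symmetric group with
-- period N = k + 1 (written suc k).

res : (k : ℕ) → ℤ → ℕ
res k m = m %ℕ suc k

-- simple reflection s_a := s_{a mod (k+1)}, as a map ℤ → ℤ:
-- exchanges r + t(k+1) and r+1 + t(k+1) for all t, where r = a mod (k+1)
s : (k : ℕ) → ℕ → ℤ → ℤ
s k a m =
  if res k m ≡ᵇ res k (+ a) then m + + 1
  else if res k m ≡ᵇ res k (+ a + + 1) then m - + 1
  else m

tr : (k : ℕ) → ℤ → ℤ → ℤ → ℤ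
tr k i j m =
  if res k m ≡ᵇ res k i then m + (j - i)
  else if res k m ≡ᵇ res k j then m - (j - i)
  else m

-- product of simple reflections s_{r1} ⋯ s_{rm} (composition of maps,
-- rightmost factor applied first)
evalWord : (k : ℕ) → List ℕ → ℤ → ℤ
evalWord k []       m = m
evalWord k (r ∷ rs) m = s k r (evalWord k rs m)

_≐_ : (ℤ → ℤ) → (ℤ → ℤ) → Set
f ≐ g = ∀ m → f m ≡ g m

sumTo : (ℤ → ℤ) → ℕ → ℤ
sumTo f zero    = + 0
sumTo f (suc n) = sumTo f n + f (+ suc n)

IsW : (k : ℕ) → (ℤ → ℤ) → Set
IsW k w =
  (∀ m → w (m + + suc k) ≡ w m + + suc k) ×
  (∀ a b → w a ≡ w b → a ≡ b) ×
  (∀ y → ∃ λ x → w x ≡ y) ×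
  (sumTo w (suc k) ≡ sumTo (λ m → m) (suc k))

Len : (k : ℕ) → (ℤ → ℤ) → ℕ → Set
Len k w n =
  (Σ (List ℕ) λ ws → length ws ≡ n × evalWord k ws ≐ w) ×
  (∀ ws → evalWord k ws ≐ w → n ℕ.≤ length ws)

Edge : (k : ℕ) → (ℤ → ℤ) → (ℤ → ℤ) → ℤ → Set
Edge k x y lab =
  IsW k x × IsW k y ×
  (Σ ℕ λ ly → Len k y ly × Len k x (suc ly)) ×
  (Σ ℤ λ i → Σ ℤ λ j →
     i ℤ.≤ + 0 × + 0 ℤ.< j × res k i ≢ res k j ×
     ((λ m → y (tr k i j m)) ≐ x) × lab ≡ y j)

StrongStrip : (k : ℕ) → (ℤ → ℤ) → (ℤ → ℤ) → ℕ → Set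
StrongStrip k w v n =
  Σ (Fin (suc n) → (ℤ → ℤ)) λ u →
  Σ (Fin n → ℤ) λ lab →
    (u fzero ≐ w) × (u (fromℕ n) ≐ v) ×
    (∀ t → Edge k (u (inject₁ t)) (u (fsuc t)) (lab t)) ×
    (∀ a b → a <ᶠ b → lab b ℤ.< lab a)

-- Diagrams. Cells (p , q): row p ≥ 1 from the top, column q ≥ 1 from the left.

Cell : Set
Cell = ℕ × ℕ

cellRes : (k : ℕ) → ℕ → ℕ → ℕ
cellRes k p q = res k (+ q - + p)

-- reading word of a diagram D (given as a Boolean predicate on cells)
-- contained in the rectangle with `rows` rows and `cols` columns:
-- bottom row first, each row right to left, rows bottom to top.
rowWord : (k : ℕ) → (ℕ → ℕ → Bool) → ℕ → ℕ → List ℕ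
rowWord k D p zero    = []
rowWord k D p (suc q) =
  (if D p (suc q) then cellRes k p (suc q) ∷ [] else []) ++ rowWord k D p q

diagWord : (k : ℕ) → (ℕ → ℕ → Bool) → (rows cols : ℕ) → List ℕ
diagWord k D zero    cols = []
diagWord k D (suc p) cols = rowWord k D (suc p) cols ++ diagWord k D p cols

IsPartitionIn : (k c : ℕ) → (ℕ → ℕ) → Set
IsPartitionIn k c lam =
  (∀ p → lam (suc (suc p)) ℕ.≤ lam (suc p)) ×
  lam 1 ℕ.≤ c ×
  (∀ p → suc k ℕ.∸ c ℕ.< p → lam p ≡ 0)

InShape : (ℕ → ℕ) → Cell → Set
InShape lam (p , q) = 1 ℕ.≤ p × 1 ℕ.≤ q × q ℕ.≤ lam p

inShapeᵇ : (ℕ → ℕ) → ℕ → ℕ → Bool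
inShapeᵇ lam p q = (1 ≤ᵇ p) ∧ (1 ≤ᵇ q) ∧ (q ≤ᵇ lam p)

memᵇ : ℕ → ℕ → List Cell → Bool
memᵇ p q []              = false
memᵇ p q ((p' , q') ∷ X) = ((p ≡ᵇ p') ∧ (q ≡ᵇ q')) ∨ memᵇ p q X

wShape : (k c : ℕ) → (ℕ → ℕ) → ℤ → ℤ
wShape k c lam = evalWord k (diagWord k (inShapeᵇ lam) (suc k ℕ.∸ c) c)

wShapeMinus : (k c : ℕ) → (ℕ → ℕ) → List Cell → ℤ → ℤ
wShapeMinus k c lam X =
  evalWord k (diagWord k (λ p q → inShapeᵇ lam p q ∧ not (memᵇ p q X)) (suc k ℕ.∸ c) c)

InRect : Cell → Cell → Cell → Set
InRect (ia , ja) (ib , jb) (p , q) = ib ℕ.≤ p × p ℕ.≤ ia × ja ℕ.≤ q × q ℕ.≤ jb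

-- The potential φ(w) = Σ_{m=1}^{k+1} max(0, w(m) - m) grows by at most one
-- under left multiplication by a simple reflection, since w(1), …, w(k+1)
-- have distinct residues; hence ℓ(w) ≥ φ(w). In the reading word of λ, row p
-- slides the position k+2-p along by λ_p and the other rows leave it alone;
-- so ℓ(w_λ) ≥ φ(w_λ) ≥ |λ|.
--
-- The reading word of λ ∖ 𝔛 has |λ| - n letters. The free corners
-- (i_a , j_b) and (i_b , j_a) of the rectangle lie in λ ∖ 𝔛, and the subword
-- B read between their letters x and y carries j_a - i_b and j_a - i_b + 1 to
-- j_b - i_a and j_b - i_a + 1: along row i_b, down a column of the rectangle
-- and along row i_a, past the missing cells x_b and x_a. Hence s_x B s_y = B,
-- both letters can be deleted, and ℓ(w_{λ∖𝔛}) ≤ |λ| - n - 2. Lengths drop by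
-- exactly one along every edge, so no strong strip of length n exists.

module Submission where

open import Data.Bool using (Bool; true; false; T; if_then_else_; _∧_; not)
import Data.Bool.Properties as Bool
open import Data.Empty using (⊥; ⊥-elim)
open import Data.Fin using (Fin; inject₁; fromℕ) renaming (zero to fzero; suc to fsuc)
open import Data.Integer as ℤ using (ℤ; +_; -[1+_]; _-_; -_)
import Data.Integer.Properties as ℤP
open import Data.Integer.DivMod using (_/ℕ_; a≡a%ℕn+[a/ℕn]*n; n%ℕd<d)
open import Data.Integer.Tactic.RingSolver using (solve-∀)
open import Tactic.MonoidSolver using (solve)
open import Data.List using (List; []; _∷_; _++_; [_]; length; reverse; map)
import Data.List.Properties as List
open import Data.List.Membership.Propositional using (_∈_; _∉_)
open import Data.List.Relation.Unary.All as All using (All; []; _∷_)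
open import Data.List.Relation.Unary.Any using (here; there)
open import Data.List.Relation.Unary.AllPairs using ([]; _∷_)
open import Data.List.Relation.Unary.Unique.Propositional using (Unique)
open import Data.Nat as ℕ using (ℕ; zero; suc; _≤_; _<_; _∸_; z≤n; s≤s; _≡ᵇ_)
import Data.Nat.DivMod as ℕD
import Data.Nat.Properties as ℕP
open import Data.Nat.Induction using (<-rec)
open import Data.Product using (Σ; ∃; _×_; _,_; proj₁; proj₂)
open import Data.Product.Properties using (,-injectiveˡ; ,-injectiveʳ)
open import Data.Sum using (inj₁; inj₂)
open import Function using (_∘_)
open import Relation.Binary.PropositionalEquality hiding ([_])
open import Relation.Nullary using (¬_; Dec; yes; no)
open import Relation.Nullary.Decidable using (dec-true; dec-false)

open import Algebra.Properties.AbelianGroup ℤP.+-0-abelianGroup using (∙-cancelˡ)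
open import Algebra.Properties.CommutativeSemigroup ℕP.+-commutativeSemigroup
  using () renaming (interchange to +-interchange; xy∙z≈xz∙y to [x+y]+z≡[x+z]+y)

open import Defs

≡ᵇ-true : ∀ {m n} → m ≡ n → (m ≡ᵇ n) ≡ true
≡ᵇ-true {m} {n} = dec-true (m ℕP.≟ n)

≡ᵇ-false : ∀ {m n} → m ≢ n → (m ≡ᵇ n) ≡ false
≡ᵇ-false {m} {n} = dec-false (m ℕP.≟ n)

≡ᵇ⇒≡ : ∀ {m n} → (m ≡ᵇ n) ≡ true → m ≡ n
≡ᵇ⇒≡ {m} {n} eq = ℕP.≡ᵇ⇒≡ m n (subst T (sym eq) _)

≢-row : ∀ {p q p' q' : ℕ} → p ≢ p' → (p , q) ≢ (p' , q')
≢-row p≢p' = p≢p' ∘ ,-injectiveˡ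

≢-col : ∀ {p q p' q' : ℕ} → q ≢ q' → (p , q) ≢ (p' , q')
≢-col q≢q' = q≢q' ∘ ,-injectiveʳ

+[m∸n]≡+m-+n : ∀ {m n} → n ≤ m → + (m ∸ n) ≡ + m - + n
+[m∸n]≡+m-+n {m} {n} n≤m = sym (trans (ℤP.m-n≡m⊖n m n) (ℤP.⊖-≥ n≤m))

lo<last : ∀ lo d → lo < suc (lo ℕ.+ d)
lo<last lo d = s≤s (ℕP.m≤m+n lo d)

last≤ : ∀ lo d → suc (lo ℕ.+ d) ≤ lo ℕ.+ suc d
last≤ lo d = ℕP.≤-reflexive (sym (ℕP.+-suc lo d))

≤-widen : ∀ lo d {q} → q ≤ lo ℕ.+ d → q ≤ lo ℕ.+ suc d
≤-widen lo d q≤ = ℕP.≤-trans q≤ (ℕP.+-monoʳ-≤ lo (ℕP.n≤1+n d))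

sumℕ : (ℕ → ℕ) → ℕ → ℕ
sumℕ f zero    = 0
sumℕ f (suc M) = sumℕ f M ℕ.+ f (suc M)

sum-cong : ∀ f g M → (∀ p → 1 ≤ p → p ≤ M → f p ≡ g p) → sumℕ f M ≡ sumℕ g M
sum-cong f g zero    eq = refl
sum-cong f g (suc M) eq = cong₂ ℕ._+_
  (sum-cong f g M (λ p 1≤p p≤M → eq p 1≤p (ℕP.m≤n⇒m≤1+n p≤M))) (eq (suc M) (s≤s z≤n) ℕP.≤-refl)

sum-zero : ∀ f M → (∀ p → 1 ≤ p → p ≤ M → f p ≡ 0) → sumℕ f M ≡ 0
sum-zero f zero    eq = refl
sum-zero f (suc M) eq = cong₂ ℕ._+_
  (sum-zero f M (λ p 1≤p p≤M → eq p 1≤p (ℕP.m≤n⇒m≤1+n p≤M))) (eq (suc M) (s≤s z≤n) ℕP.≤-refl)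

sum-≤-+ : ∀ f g h M → (∀ p → f p ≤ g p ℕ.+ h p) → sumℕ f M ≤ sumℕ g M ℕ.+ sumℕ h M
sum-≤-+ f g h zero    le = z≤n
sum-≤-+ f g h (suc M) le = ℕP.≤-trans (ℕP.+-mono-≤ (sum-≤-+ f g h M le) (le (suc M)))
  (ℕP.≤-reflexive (+-interchange (sumℕ g M) (sumℕ h M) (g (suc M)) (h (suc M))))

sum-prefix-≤ : ∀ f M M' → M ≤ M' → sumℕ f M ≤ sumℕ f M'
sum-prefix-≤ f M M' M≤M' with ℕP.m≤n⇒m<n∨m≡n M≤M'
... | inj₂ refl = ℕP.≤-refl
sum-prefix-≤ f M (suc M') _ | inj₁ M<1+M' =
  ℕP.≤-trans (sum-prefix-≤ f M M' (ℕP.≤-pred M<1+M')) (ℕP.m≤m+n _ _)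

sum-update : ∀ f g M z → 1 ≤ z → z ≤ M → (∀ p → p ≢ z → f p ≡ g p) → f z ≡ suc (g z) →
             sumℕ f M ≡ suc (sumℕ g M)
sum-update f g zero    z 1≤z z≤0 agree fz = ⊥-elim (ℕP.<-irrefl refl (ℕP.<-≤-trans 1≤z z≤0))
sum-update f g (suc M) z 1≤z z≤M agree fz with suc M ℕP.≟ z
... | yes refl = trans (cong₂ ℕ._+_ (sum-cong f g M earlier) fz) (ℕP.+-suc (sumℕ g M) (g (suc M)))
  where
  earlier : ∀ p → 1 ≤ p → p ≤ M → f p ≡ g p
  earlier p _ p≤M = agree p (λ p≡ → ℕP.<-irrefl p≡ (s≤s p≤M))
... | no  M≢z  = cong₂ ℕ._+_ (sum-update f g M z 1≤z z≤M' agree fz) (agree (suc M) M≢z)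
  where
  z≤M' = ℕP.≤-pred (ℕP.≤∧≢⇒< z≤M (M≢z ∘ sym))

indicator : Bool → ℕ
indicator true  = 1
indicator false = 0

sum-indicator≤1 : ∀ (b : ℕ → Bool) M →
  (∀ p p' → 1 ≤ p → p < p' → p' ≤ M → b p ≡ true → b p' ≡ true → ⊥) →
  sumℕ (λ p → indicator (b p)) M ≤ 1
sum-indicator≤1 b zero    atMostOne = z≤n
sum-indicator≤1 b (suc M) atMostOne with b (suc M) in bM
... | false = ℕP.≤-trans (ℕP.≤-reflexive (ℕP.+-identityʳ _))
    (sum-indicator≤1 b M (λ p p' 1≤p p<p' p'≤M → atMostOne p p' 1≤p p<p' (ℕP.m≤n⇒m≤1+n p'≤M)))
... | true  = ℕP.≤-reflexive (cong (ℕ._+ 1) (sum-zero _ M earlier-false))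
  where
  earlier-false : ∀ p → 1 ≤ p → p ≤ M → indicator (b p) ≡ 0
  earlier-false p 1≤p p≤M with b p in bp
  ... | false = refl
  ... | true  = ⊥-elim (atMostOne p (suc M) 1≤p (s≤s p≤M) ℕP.≤-refl bp bM)

posPart : ℤ → ℕ
posPart (+ n)    = n
posPart -[1+ n ] = 0

posPart-suc : ∀ y → posPart (y ℤ.+ + 1) ≤ posPart y ℕ.+ 1
posPart-suc (+ n)          = ℕP.≤-refl
posPart-suc -[1+ zero ]    = z≤n
posPart-suc -[1+ suc n ]   = z≤n

posPart-pred : ∀ y → posPart (y - + 1) ≤ posPart y
posPart-pred (+ zero)  = z≤n
posPart-pred (+ suc n) = ℕP.n≤1+n n
posPart-pred -[1+ n ]  = z≤n

minimal : {P : ℕ → Set} → (∀ n → Dec (P n)) → ∀ n → P n → ∃ λ m → P m × (∀ m' → P m' → m ≤ m')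
minimal {P} P? = <-rec (λ n → P n → Minimum) step
  where
  Minimum = ∃ λ m → P m × (∀ m' → P m' → m ≤ m')
  step : ∀ n → (∀ {m} → m < n → P m → Minimum) → P n → Minimum
  step n smaller Pn with ℕP.anyUpTo? P? n
  ... | yes (m , m<n , Pm) = smaller m<n Pm
  ... | no  none           = n , Pn , λ m' Pm' → ℕP.≮⇒≥ (λ m'<n → none (m' , m'<n , Pm'))

length-cancel-pair : ∀ {A : Set} (us vs ws : List A) x y →
                     length (us ++ x ∷ vs ++ y ∷ ws) ≡ suc (suc (length (us ++ vs ++ ws)))
length-cancel-pair us vs ws x y
  rewrite List.length-++ us {x ∷ vs ++ y ∷ ws} | List.length-++ vs {y ∷ ws}
        | List.length-++ us {vs ++ ws} | List.length-++ vs {ws}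
        | ℕP.+-suc (length vs) (length ws) | ℕP.+-suc (length us) (suc (length vs ℕ.+ length ws))
        | ℕP.+-suc (length us) (length vs ℕ.+ length ws) = refl

reassociate : ∀ {A : Set} (t u x v m w y z l : List A) →
  t ++ ((u ++ x ++ v) ++ (m ++ ((w ++ y ++ z) ++ l))) ≡ (t ++ u) ++ x ++ (v ++ m ++ w) ++ y ++ z ++ l
reassociate {A} t u x v m w y z l = solve (List.++-monoid A)

module Residues (k : ℕ) where
  open import Data.Integer using (_+_; _*_)

  private
    N : ℤ
    N = + suc k

  multiple<N⇒0 : ∀ d t → d < suc k → + d ≡ t * N → d ≡ 0
  multiple<N⇒0 d (+ zero)    d<N d≡tN = ℤP.+-injective d≡tN
  multiple<N⇒0 d (+ suc t)   d<N d≡tN =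
    ⊥-elim (ℕP.<-irrefl (ℤP.+-injective d≡tN) (ℕP.<-≤-trans d<N (ℕP.m≤m+n (suc k) (t ℕ.* suc k))))
  multiple<N⇒0 d -[1+ t ]    d<N ()

  remainder-≤ : ∀ r r' t t' → r < suc k → + r + t * N ≡ + r' + t' * N → r ≤ r'
  remainder-≤ r r' t t' r<N eq with r ℕ.≤? r'
  ... | yes r≤r' = r≤r'
  ... | no  r≰r' = ⊥-elim (ℕP.<⇒≢ (ℕP.m<n⇒0<n∸m r'<r) (sym (multiple<N⇒0 (r ∸ r') (t' - t) d<N d≡)))
    where
    r'<r = ℕP.≰⇒> r≰r'
    d<N : r ∸ r' < suc k
    d<N = ℕP.≤-<-trans (ℕP.m∸n≤m r r') r<N
    difference : ∀ x y s s' → x + s * N ≡ y + s' * N → x - y ≡ (s' - s) * N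
    difference x y s s' e = begin
      x - y                     ≡⟨ rearrange₁ x y s N ⟩
      (x + s * N) - s * N - y   ≡⟨ cong (λ z → z - s * N - y) e ⟩
      (y + s' * N) - s * N - y  ≡⟨ rearrange₂ y s s' N ⟩
      (s' - s) * N              ∎
      where
      open ≡-Reasoning
      rearrange₁ : ∀ x y s N → x - y ≡ (x + s * N) - s * N - y
      rearrange₁ = solve-∀
      rearrange₂ : ∀ y s s' N → (y + s' * N) - s * N - y ≡ (s' - s) * N
      rearrange₂ = solve-∀
    d≡ : + (r ∸ r') ≡ (t' - t) * N
    d≡ = trans (+[m∸n]≡+m-+n (ℕP.<⇒≤ r'<r)) (difference (+ r) (+ r') t t' eq)

  res<N : ∀ x → res k x < suc k
  res<N x = n%ℕd<d x (suc k)

  res-unique : ∀ x r t → r < suc k → x ≡ + r + t * N → res k x ≡ r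
  res-unique x r t r<N x≡ = ℕP.≤-antisym
    (remainder-≤ (res k x) r (x /ℕ suc k) t (res<N x) (trans (sym division) x≡))
    (remainder-≤ r (res k x) t (x /ℕ suc k) r<N (trans (sym x≡) division))
    where
    division = a≡a%ℕn+[a/ℕn]*n x (suc k)

  res-+ : ∀ r → r < suc k → res k (+ r) ≡ r
  res-+ r r<N = res-unique (+ r) r (+ 0) r<N (sym (ℤP.+-identityʳ (+ r)))

  res-idem : ∀ x → res k (+ res k x) ≡ res k x
  res-idem x = res-+ (res k x) (res<N x)

  res-periodic : ∀ x t → res k (x + t * N) ≡ res k x
  res-periodic x t = res-unique (x + t * N) (res k x) (x /ℕ suc k + t) (res<N x) (begin
    x + t * N                                  ≡⟨ cong (_+ t * N) (a≡a%ℕn+[a/ℕn]*n x (suc k)) ⟩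
    + res k x + (x /ℕ suc k) * N + t * N       ≡⟨ regroup (+ res k x) (x /ℕ suc k) t N ⟩
    + res k x + (x /ℕ suc k + t) * N           ∎)
    where
    open ≡-Reasoning
    regroup : ∀ r q t N → r + q * N + t * N ≡ r + (q + t) * N
    regroup = solve-∀

  res-≡⇒∃multiple : ∀ x y → res k x ≡ res k y → ∃ λ t → y ≡ x + t * N
  res-≡⇒∃multiple x y eq = y /ℕ suc k - x /ℕ suc k , (begin
    y                                          ≡⟨ a≡a%ℕn+[a/ℕn]*n y (suc k) ⟩
    + res k y + qy * N                         ≡⟨ cong (λ r → + r + qy * N) (sym eq) ⟩
    + res k x + qy * N                         ≡⟨ regroup (+ res k x) qx qy N ⟩
    (+ res k x + qx * N) + (qy - qx) * N       ≡⟨ cong (_+ (qy - qx) * N) (sym (a≡a%ℕn+[a/ℕn]*n x (suc k))) ⟩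
    x + (qy - qx) * N                          ∎)
    where
    open ≡-Reasoning
    qx = x /ℕ suc k
    qy = y /ℕ suc k
    regroup : ∀ r a b N → r + b * N ≡ (r + a * N) + (b - a) * N
    regroup = solve-∀

  res-shift : ∀ x y → res k x ≡ res k y → ∀ d → res k (x + d) ≡ res k (y + d)
  res-shift x y eq d with res-≡⇒∃multiple x y eq
  ... | t , refl = sym (trans (cong (res k) (swap x t N d)) (res-periodic (x + d) t))
    where
    swap : ∀ x t N d → (x + t * N) + d ≡ (x + d) + t * N
    swap = solve-∀

  res-≢-+ : ∀ x d → 0 < d → d < suc k → res k x ≢ res k (x + + d)
  res-≢-+ x d 0<d d<N eq with res-≡⇒∃multiple x (x + + d) eq
  ... | t , x+d≡ = ℕP.<⇒≢ 0<d (sym (multiple<N⇒0 d t d<N (∙-cancelˡ x (+ d) (t * N) x+d≡)))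

  res-diff-≢ : ∀ a b a' b' → a ℕ.+ b' < a' ℕ.+ b → a' ℕ.+ b < a ℕ.+ b' ℕ.+ suc k →
               res k (+ a - + b) ≢ res k (+ a' - + b')
  res-diff-≢ a b a' b' lower upper eq =
    res-≢-+ (+ a - + b) d (ℕP.m<n⇒0<n∸m lower) d<N (trans eq (cong (res k) a'-b'≡))
    where
    d = a' ℕ.+ b ∸ (a ℕ.+ b')
    d<N : d < suc k
    d<N = ℕP.+-cancelʳ-< (a ℕ.+ b') d (suc k)
      (subst₂ _<_ (sym (ℕP.m∸n+n≡m (ℕP.<⇒≤ lower))) (ℕP.+-comm (a ℕ.+ b') (suc k)) upper)
    a'-b'≡ : + a' - + b' ≡ (+ a - + b) + + d
    a'-b'≡ = begin
      + a' - + b'                          ≡⟨ shuffle (+ a) (+ b) (+ a') (+ b') ⟩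
      (+ a - + b) + ((+ a' + + b) - (+ a + + b'))
        ≡⟨ cong (λ z → (+ a - + b) + z) (sym (+[m∸n]≡+m-+n (ℕP.<⇒≤ lower))) ⟩
      (+ a - + b) + + d                    ∎
      where
      open ≡-Reasoning
      shuffle : ∀ a b a' b' → a' - b' ≡ (a - b) + ((a' + b) - (a + b'))
      shuffle = solve-∀

module Reflections (k : ℕ) where
  open import Data.Integer using (_+_; _*_)
  open Residues k

  s-up : ∀ a m → res k m ≡ res k (+ a) → s k a m ≡ m + + 1
  s-up a m eq rewrite ≡ᵇ-true eq = refl

  s-fix : ∀ a m → res k m ≢ res k (+ a) → res k m ≢ res k (+ a + + 1) → s k a m ≡ m
  s-fix a m ne₁ ne₂ rewrite ≡ᵇ-false ne₁ | ≡ᵇ-false ne₂ = refl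

  s-periodic : ∀ a m t → s k a (m + t * + suc k) ≡ s k a m + t * + suc k
  s-periodic a m t rewrite res-periodic m t with res k m ≡ᵇ res k (+ a)
  ... | true = shift-up m t (+ suc k) (+ 1)
    where
    shift-up : ∀ m t N d → (m + t * N) + d ≡ (m + d) + t * N
    shift-up = solve-∀
  ... | false with res k m ≡ᵇ res k (+ a + + 1)
  ... | true = shift-down m t (+ suc k)
    where
    shift-down : ∀ m t N → (m + t * N) - + 1 ≡ (m - + 1) + t * N
    shift-down = solve-∀
  ... | false = refl

  s-up-res : ∀ z m → res k m ≡ res k z → s k (res k z) m ≡ m + + 1
  s-up-res z m eq = s-up (res k z) m (trans eq (sym (res-idem z)))

  s-fix-res : ∀ z m → res k m ≢ res k z → res k m ≢ res k (z + + 1) → s k (res k z) m ≡ m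
  s-fix-res z m ne₁ ne₂ = s-fix (res k z) m
    (λ eq → ne₁ (trans eq (res-idem z)))
    (λ eq → ne₂ (trans eq (res-shift (+ res k z) z (res-idem z) (+ 1))))

  module _ (1≤k : 1 ≤ k) where

    res-≢-suc : ∀ x → res k x ≢ res k (x + + 1)
    res-≢-suc x = res-≢-+ x 1 (s≤s z≤n) (s≤s 1≤k)

    s-down : ∀ a m → res k m ≡ res k (+ a + + 1) → s k a m ≡ m - + 1
    s-down a m eq
      rewrite ≡ᵇ-false (λ eq' → res-≢-suc (+ a) (trans (sym eq') eq)) | ≡ᵇ-true eq = refl

    s-down-res : ∀ z m → res k m ≡ res k (z + + 1) → s k (res k z) m ≡ m - + 1
    s-down-res z m eq =
      s-down (res k z) m (trans eq (sym (res-shift (+ res k z) z (res-idem z) (+ 1))))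

    s-involutive : ∀ a m → s k a (s k a m) ≡ m
    s-involutive a m with res k m ℕP.≟ res k (+ a)
    ... | yes eq = begin
      s k a (s k a m)     ≡⟨ cong (s k a) (s-up a m eq) ⟩
      s k a (m + + 1)     ≡⟨ s-down a (m + + 1) (res-shift m (+ a) eq (+ 1)) ⟩
      (m + + 1) - + 1     ≡⟨ cancel m ⟩
      m                   ∎
      where
      open ≡-Reasoning
      cancel : ∀ m → (m + + 1) - + 1 ≡ m
      cancel = solve-∀
    ... | no ne with res k m ℕP.≟ res k (+ a + + 1)
    ... | yes eq = begin
      s k a (s k a m)     ≡⟨ cong (s k a) (s-down a m eq) ⟩
      s k a (m - + 1)     ≡⟨ s-up a (m - + 1) (trans (res-shift m (+ a + + 1) eq (- + 1))
                               (cong (res k) (cancel₁ (+ a)))) ⟩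
      (m - + 1) + + 1     ≡⟨ cancel₂ m ⟩
      m                   ∎
      where
      open ≡-Reasoning
      cancel₁ : ∀ a → (a + + 1) + - + 1 ≡ a
      cancel₁ = solve-∀
      cancel₂ : ∀ m → (m - + 1) + + 1 ≡ m
      cancel₂ = solve-∀
    ... | no ne' = trans (cong (s k a) (s-fix a m ne ne')) (s-fix a m ne ne')

module Words (k : ℕ) where
  open import Data.Integer using (_+_; _*_)
  open Residues k
  open Reflections k

  eval-++ : ∀ xs ys m → evalWord k (xs ++ ys) m ≡ evalWord k xs (evalWord k ys m)
  eval-++ []       ys m = refl
  eval-++ (x ∷ xs) ys m = cong (s k x) (eval-++ xs ys m)

  eval-periodic : ∀ ws m t → evalWord k ws (m + t * + suc k) ≡ evalWord k ws m + t * + suc k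
  eval-periodic []       m t = refl
  eval-periodic (x ∷ ws) m t =
    trans (cong (s k x) (eval-periodic ws m t)) (s-periodic x (evalWord k ws m) t)

  eval-res-cong : ∀ ws m m' → res k m ≡ res k m' → res k (evalWord k ws m) ≡ res k (evalWord k ws m')
  eval-res-cong ws m m' eq with res-≡⇒∃multiple m m' eq
  ... | t , refl = sym (trans (cong (res k) (eval-periodic ws m t)) (res-periodic (evalWord k ws m) t))

  module _ (1≤k : 1 ≤ k) where

    eval-reverse : ∀ ws m → evalWord k (reverse ws) (evalWord k ws m) ≡ m
    eval-reverse []       m = refl
    eval-reverse (x ∷ ws) m = begin
      evalWord k (reverse (x ∷ ws)) (s k x (evalWord k ws m))
        ≡⟨ cong (λ l → evalWord k l (s k x (evalWord k ws m))) (List.unfold-reverse x ws) ⟩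
      evalWord k (reverse ws ++ [ x ]) (s k x (evalWord k ws m))
        ≡⟨ eval-++ (reverse ws) [ x ] _ ⟩
      evalWord k (reverse ws) (s k x (s k x (evalWord k ws m)))
        ≡⟨ cong (evalWord k (reverse ws)) (s-involutive 1≤k x _) ⟩
      evalWord k (reverse ws) (evalWord k ws m)
        ≡⟨ eval-reverse ws m ⟩
      m ∎
      where open ≡-Reasoning

    eval-res-injective : ∀ ws m m' → res k (evalWord k ws m) ≡ res k (evalWord k ws m') → res k m ≡ res k m'
    eval-res-injective ws m m' eq =
      subst₂ (λ a b → res k a ≡ res k b) (eval-reverse ws m) (eval-reverse ws m')
        (eval-res-cong (reverse ws) _ _ eq)

module Conjugation (k : ℕ) (1≤k : 1 ≤ k) where
  open import Data.Integer using (_+_; _*_)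
  open Residues k
  open Reflections k
  open Words k

  private
    N : ℤ
    N = + suc k
    +1-shift : ∀ v t N → (v + t * N) + + 1 ≡ (v + + 1) + t * N
    +1-shift = solve-∀
    -1-shift : ∀ v t N → ((v + + 1) + t * N) - + 1 ≡ v + t * N
    -1-shift = solve-∀

  s-conjugate : ∀ B v x → evalWord k B v ≡ x → evalWord k B (v + + 1) ≡ x + + 1 →
                ∀ z → s k (res k x) (evalWord k B (s k (res k v) z)) ≡ evalWord k B z
  s-conjugate B v x Bv Bv+1 z with res k z ℕP.≟ res k v
  ... | yes z≡v with res-≡⇒∃multiple v z (sym z≡v)
  ...   | t , refl = begin
    s k (res k x) (evalWord k B (s k (res k v) (v + t * N)))
      ≡⟨ cong (λ u → s k (res k x) (evalWord k B u)) (trans (s-up-res v (v + t * N) z≡v) (+1-shift v t N)) ⟩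
    s k (res k x) (evalWord k B ((v + + 1) + t * N))
      ≡⟨ cong (s k (res k x)) (trans (eval-periodic B (v + + 1) t) (cong (_+ t * N) Bv+1)) ⟩
    s k (res k x) ((x + + 1) + t * N)
      ≡⟨ s-down-res 1≤k x ((x + + 1) + t * N) (res-periodic (x + + 1) t) ⟩
    ((x + + 1) + t * N) - + 1
      ≡⟨ -1-shift x t N ⟩
    x + t * N
      ≡⟨ sym (trans (eval-periodic B v t) (cong (_+ t * N) Bv)) ⟩
    evalWord k B (v + t * N) ∎
    where open ≡-Reasoning
  s-conjugate B v x Bv Bv+1 z | no z≢v with res k z ℕP.≟ res k (v + + 1)
  ... | yes z≡v+1 with res-≡⇒∃multiple (v + + 1) z (sym z≡v+1)
  ...   | t , refl = begin
    s k (res k x) (evalWord k B (s k (res k v) ((v + + 1) + t * N)))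
      ≡⟨ cong (λ u → s k (res k x) (evalWord k B u))
           (trans (s-down-res 1≤k v ((v + + 1) + t * N) z≡v+1) (-1-shift v t N)) ⟩
    s k (res k x) (evalWord k B (v + t * N))
      ≡⟨ cong (s k (res k x)) (trans (eval-periodic B v t) (cong (_+ t * N) Bv)) ⟩
    s k (res k x) (x + t * N)
      ≡⟨ s-up-res x (x + t * N) (res-periodic x t) ⟩
    (x + t * N) + + 1
      ≡⟨ +1-shift x t N ⟩
    (x + + 1) + t * N
      ≡⟨ sym (trans (eval-periodic B (v + + 1) t) (cong (_+ t * N) Bv+1)) ⟩
    evalWord k B ((v + + 1) + t * N) ∎
    where open ≡-Reasoning
  s-conjugate B v x Bv Bv+1 z | no z≢v | no z≢v+1 =
    trans (cong (λ u → s k (res k x) (evalWord k B u)) (s-fix-res v z z≢v z≢v+1))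
          (s-fix-res x _ Bz≢x Bz≢x+1)
    where
    Bz≢x : res k (evalWord k B z) ≢ res k x
    Bz≢x eq = z≢v (eval-res-injective 1≤k B z v (trans eq (sym (cong (res k) Bv))))
    Bz≢x+1 : res k (evalWord k B z) ≢ res k (x + + 1)
    Bz≢x+1 eq = z≢v+1 (eval-res-injective 1≤k B z (v + + 1) (trans eq (sym (cong (res k) Bv+1))))

  eval-cancel-pair : ∀ A x B y C → (∀ z → s k x (evalWord k B (s k y z)) ≡ evalWord k B z) →
                     evalWord k (A ++ x ∷ B ++ y ∷ C) ≐ evalWord k (A ++ B ++ C)
  eval-cancel-pair A x B y C conj m = begin
    evalWord k (A ++ x ∷ B ++ y ∷ C) m                  ≡⟨ eval-++ A _ m ⟩
    evalWord k A (s k x (evalWord k (B ++ y ∷ C) m))    ≡⟨ cong (λ u → evalWord k A (s k x u)) (eval-++ B _ m) ⟩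
    evalWord k A (s k x (evalWord k B (s k y (evalWord k C m))))
                                                        ≡⟨ cong (evalWord k A) (conj (evalWord k C m)) ⟩
    evalWord k A (evalWord k B (evalWord k C m))        ≡⟨ cong (evalWord k A) (sym (eval-++ B C m)) ⟩
    evalWord k A (evalWord k (B ++ C) m)                ≡⟨ sym (eval-++ A _ m) ⟩
    evalWord k (A ++ B ++ C) m                          ∎
    where open ≡-Reasoning

module Potential (k : ℕ) where
  open import Data.Integer using (_+_; _*_)
  open Residues k
  open Words k

  -- The position slid along by row p of a diagram: its residue 1 - p is that
  -- of the first cell (p , 1). For p = 1 … k+1 these are k+1, …, 1.
  rowEntry : ℕ → ℤ
  rowEntry p = + suc (suc k) - + p

  potential : (ℤ → ℤ) → ℕ
  potential w = sumℕ (λ p → posPart (w (rowEntry p) - rowEntry p)) (suc k)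

  potential-cong : ∀ w w' → w ≐ w' → potential w ≡ potential w'
  potential-cong w w' w≐w' =
    sum-cong _ _ (suc k) (λ p _ _ → cong (λ z → posPart (z - rowEntry p)) (w≐w' (rowEntry p)))

  rowEntry-res-≢ : ∀ p p' → 1 ≤ p → p < p' → p' ≤ suc k → res k (rowEntry p) ≢ res k (rowEntry p')
  rowEntry-res-≢ p p' 1≤p p<p' p'≤N eq = res-diff-≢ (suc (suc k)) p' (suc (suc k)) p
    (ℕP.+-monoʳ-< (suc (suc k)) p<p')
    (ℕP.≤-<-trans (ℕP.+-monoʳ-≤ (suc (suc k)) p'≤N)
      (subst (suc (suc k) ℕ.+ suc k <_) (sym (ℕP.+-assoc (suc (suc k)) p (suc k)))
        (ℕP.+-monoʳ-< (suc (suc k)) (ℕP.m<n+m (suc k) 1≤p))))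
    (sym eq)

  s-displacement : ∀ a y x → posPart (s k a y - x) ≤ posPart (y - x) ℕ.+ indicator (res k y ≡ᵇ res k (+ a))
  s-displacement a y x with res k y ≡ᵇ res k (+ a)
  ... | true = subst (λ z → posPart z ≤ posPart (y - x) ℕ.+ 1) (sym (swap y x)) (posPart-suc (y - x))
    where
    swap : ∀ y x → (y + + 1) - x ≡ (y - x) + + 1
    swap = solve-∀
  ... | false with res k y ≡ᵇ res k (+ a + + 1)
  ... | true = subst (λ z → posPart z ≤ posPart (y - x) ℕ.+ 0) (sym (swap y x))
                 (subst (posPart ((y - x) - + 1) ≤_) (sym (ℕP.+-identityʳ _)) (posPart-pred (y - x)))
    where
    swap : ∀ y x → (y - + 1) - x ≡ (y - x) - + 1
    swap = solve-∀
  ... | false = ℕP.m≤m+n _ 0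

  module _ (1≤k : 1 ≤ k) where

    -- A letter s_a moves up only the positions of residue a, and the window
    -- positions w(rowEntry p) have pairwise distinct residues.
    potential-s≤ : ∀ a ws → potential (λ m → s k a (evalWord k ws m)) ≤ potential (evalWord k ws) ℕ.+ 1
    potential-s≤ a ws = ℕP.≤-trans
      (sum-≤-+ _ _ _ (suc k) (λ p → s-displacement a (evalWord k ws (rowEntry p)) (rowEntry p)))
      (ℕP.+-monoʳ-≤ (potential (evalWord k ws)) (sum-indicator≤1 _ (suc k) distinct))
      where
      distinct : ∀ p p' → 1 ≤ p → p < p' → p' ≤ suc k →
                 (res k (evalWord k ws (rowEntry p)) ≡ᵇ res k (+ a)) ≡ true →
                 (res k (evalWord k ws (rowEntry p')) ≡ᵇ res k (+ a)) ≡ true → ⊥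
      distinct p p' 1≤p p<p' p'≤N eq eq' = rowEntry-res-≢ p p' 1≤p p<p' p'≤N
        (eval-res-injective 1≤k ws _ _
          (trans (≡ᵇ⇒≡ eq) (sym (≡ᵇ⇒≡ eq'))))

    potential≤length : ∀ ws → potential (evalWord k ws) ≤ length ws
    potential≤length []       = ℕP.≤-reflexive
      (sum-zero _ (suc k) (λ p _ _ → cong posPart (ℤP.+-inverseʳ (rowEntry p))))
    potential≤length (a ∷ ws) = ℕP.≤-trans (potential-s≤ a ws)
      (subst (_≤ suc (length ws)) (ℕP.+-comm 1 _) (s≤s (potential≤length ws)))

    potential≤Len : ∀ w a → Len k w a → potential w ≤ a
    potential≤Len w a ((ws , length≡a , ws≐w) , _) =
      subst₂ _≤_ (potential-cong _ _ ws≐w) length≡a (potential≤length ws)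

module LengthFunction (k : ℕ) where
  open import Data.Integer using (_+_; _*_)
  open Residues k
  open Reflections k
  open Words k

  ≐-from-window : ∀ ws ws' → (∀ {i} → i < suc k → evalWord k ws (+ i) ≡ evalWord k ws' (+ i)) →
                  evalWord k ws ≐ evalWord k ws'
  ≐-from-window ws ws' agree m = begin
    evalWord k ws m                ≡⟨ cong (evalWord k ws) division ⟩
    evalWord k ws (+ r + q * N)    ≡⟨ eval-periodic ws (+ r) q ⟩
    evalWord k ws (+ r) + q * N    ≡⟨ cong (_+ q * N) (agree (res<N m)) ⟩
    evalWord k ws' (+ r) + q * N   ≡⟨ sym (eval-periodic ws' (+ r) q) ⟩
    evalWord k ws' (+ r + q * N)   ≡⟨ cong (evalWord k ws') (sym division) ⟩
    evalWord k ws' m               ∎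
    where
    open ≡-Reasoning
    N = + suc k
    r = res k m
    q = m /ℕ suc k
    division = a≡a%ℕn+[a/ℕn]*n m (suc k)

  eval-≐? : ∀ ws ws' → Dec (evalWord k ws ≐ evalWord k ws')
  eval-≐? ws ws' with ℕP.allUpTo? (λ i → evalWord k ws (+ i) ℤ.≟ evalWord k ws' (+ i)) (suc k)
  ... | yes agree = yes (≐-from-window ws ws' agree)
  ... | no differ = no (λ agree → differ (λ {i} _ → agree (+ i)))

  res-mod : ∀ a → res k (+ (a ℕ.% suc k)) ≡ res k (+ a)
  res-mod a = ℕD.m%n%n≡m%n a (suc k)

  s-mod : ∀ a m → s k (a ℕ.% suc k) m ≡ s k a m
  s-mod a m rewrite res-mod a | res-shift (+ (a ℕ.% suc k)) (+ a) (res-mod a) (+ 1) = refl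

  eval-mod : ∀ ws m → evalWord k (map (ℕ._% suc k) ws) m ≡ evalWord k ws m
  eval-mod []       m = refl
  eval-mod (a ∷ ws) m = trans (s-mod a (evalWord k (map (ℕ._% suc k) ws) m)) (cong (s k a) (eval-mod ws m))

  all-mod : ∀ ws → All (_< suc k) (map (ℕ._% suc k) ws)
  all-mod []       = []
  all-mod (a ∷ ws) = ℕD.m%n<n a (suc k) ∷ all-mod ws

  boundedWord? : ∀ m (P : List ℕ → Set) → (∀ ws → Dec (P ws)) →
                 Dec (∃ λ ws → length ws ≡ m × P ws × All (_< suc k) ws)
  boundedWord? zero P P? with P? []
  ... | yes P[] = yes ([] , refl , P[] , [])
  ... | no ¬P[] = no λ { ([] , _ , P[] , _) → ¬P[] P[] }
  boundedWord? (suc m) P P?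
    with ℕP.anyUpTo? (λ a → boundedWord? m (λ ws → P (a ∷ ws)) (λ ws → P? (a ∷ ws))) (suc k)
  ... | yes (a , a<N , ws , len , Pws , bounded) = yes (a ∷ ws , cong suc len , Pws , a<N ∷ bounded)
  ... | no none = no λ { (a ∷ ws , len , Pws , a<N ∷ bounded) →
                           none (a , a<N , ws , ℕP.suc-injective len , Pws , bounded) }

  -- Letters may be reduced modulo k+1, so a shortest word exists among
  -- the finitely many words over 0, …, k of each length.
  Len-exists : ∀ ws → ∃ (Len k (evalWord k ws))
  Len-exists ws with minimal Expressible? (length ws) (ws , refl , λ _ → refl)
    where
    Expressible : ℕ → Set
    Expressible m = ∃ λ ws' → length ws' ≡ m × evalWord k ws' ≐ evalWord k ws
    Expressible? : ∀ m → Dec (Expressible m)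
    Expressible? m with boundedWord? m (λ ws' → evalWord k ws' ≐ evalWord k ws) (λ ws' → eval-≐? ws' ws)
    ... | yes (ws' , len , eq , _) = yes (ws' , len , eq)
    ... | no none = no λ { (ws' , len , eq) →
      none (map (ℕ._% suc k) ws' , trans (List.length-map _ ws') len ,
            (λ m → trans (eval-mod ws' m) (eq m)) , all-mod ws') }
  ... | b , expressible , least = b , expressible , λ ws' eq → least (length ws') (ws' , refl , eq)

  Len-unique : ∀ w a b → Len k w a → Len k w b → a ≡ b
  Len-unique w a b ((wa , la , ea) , ma) ((wb , lb , eb) , mb) =
    ℕP.≤-antisym (subst (a ≤_) lb (ma wb eb)) (subst (b ≤_) la (mb wa ea))

  Len-resp-≐ : ∀ w w' a → w ≐ w' → Len k w a → Len k w' a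
  Len-resp-≐ w w' a w≐w' ((ws , len , eq) , least) =
    (ws , len , λ x → trans (eq x) (w≐w' x)) , λ ws' eq' → least ws' (λ x → trans (eq' x) (sym (w≐w' x)))

  edge-Len : ∀ {x y lab} → Edge k x y lab → ∃ λ ly → Len k y ly × Len k x (suc ly)
  edge-Len (_ , _ , lengths , _) = lengths

  path-Len : ∀ n (u : Fin (suc n) → (ℤ → ℤ)) →
    (∀ t → ∃ λ ly → Len k (u (fsuc t)) ly × Len k (u (inject₁ t)) (suc ly)) →
    ∀ a b → Len k (u fzero) a → Len k (u (fromℕ n)) b → a ≡ b ℕ.+ n
  path-Len zero    u steps a b La Lb = trans (Len-unique _ a b La Lb) (sym (ℕP.+-identityʳ b))
  path-Len (suc n) u steps a b La Lb with steps fzero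
  ... | ly , L₁ , L₀ = trans (Len-unique _ a (suc ly) La L₀)
    (trans (cong suc (path-Len n (λ t → u (fsuc t)) (λ t → steps (fsuc t)) ly b L₁ Lb)) (sym (ℕP.+-suc b n)))

  no-StrongStrip : ∀ w v n a b → Len k w a → Len k v b → b ℕ.+ n < a → ¬ StrongStrip k w v n
  no-StrongStrip w v n a b La Lb b+n<a (u , _ , start , end , edges , _) =
    ℕP.<-irrefl (sym (path-Len n u (λ t → edge-Len (edges t)) a b
      (Len-resp-≐ w (u fzero) a (λ x → sym (start x)) La)
      (Len-resp-≐ v (u (fromℕ n)) b (λ x → sym (end x)) Lb))) b+n<a

Diagram : Set
Diagram = ℕ → ℕ → Bool

inShapeᵇ-complete : ∀ lam p q → InShape lam (p , q) → inShapeᵇ lam p q ≡ true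
inShapeᵇ-complete lam (suc p) (suc q) (_ , _ , q≤) = dec-true (suc q ℕP.≤? lam (suc p)) q≤

inShapeᵇ-sound : ∀ lam p q → inShapeᵇ lam p q ≡ true → InShape lam (p , q)
inShapeᵇ-sound lam (suc p) (suc q) eq =
  s≤s z≤n , s≤s z≤n , ℕP.≤ᵇ⇒≤ (suc q) (lam (suc p)) (subst T (sym eq) _)

memᵇ⇒∈ : ∀ p q Y → memᵇ p q Y ≡ true → (p , q) ∈ Y
memᵇ⇒∈ p q ((p' , q') ∷ Y) eq with p ≡ᵇ p' in eq₁ | q ≡ᵇ q' in eq₂
... | true  | true  = here (cong₂ _,_ (≡ᵇ⇒≡ eq₁) (≡ᵇ⇒≡ eq₂))
... | true  | false = there (memᵇ⇒∈ p q Y eq)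
... | false | _     = there (memᵇ⇒∈ p q Y eq)

∈⇒memᵇ : ∀ p q Y → (p , q) ∈ Y → memᵇ p q Y ≡ true
∈⇒memᵇ p q ((p' , q') ∷ Y) (here refl) rewrite ≡ᵇ-true {p} refl | ≡ᵇ-true {q} refl = refl
∈⇒memᵇ p q ((p' , q') ∷ Y) (there p,q∈Y) rewrite ∈⇒memᵇ p q Y p,q∈Y = Bool.∨-zeroʳ _

∉⇒memᵇ : ∀ p q Y → (p , q) ∉ Y → memᵇ p q Y ≡ false
∉⇒memᵇ p q Y ∉Y with memᵇ p q Y in eq
... | false = refl
... | true  = ⊥-elim (∉Y (memᵇ⇒∈ p q Y eq))

module ReadingWords (k : ℕ) where

  cellLetter : Diagram → ℕ → ℕ → List ℕ
  cellLetter D p q = if D p q then cellRes k p q ∷ [] else []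

  segment : Diagram → ℕ → ℕ → ℕ → List ℕ
  segment D p lo zero = []
  segment D p lo (suc d) = cellLetter D p (suc (lo ℕ.+ d)) ++ segment D p lo d

  block : Diagram → ℕ → ℕ → ℕ → List ℕ
  block D c lo zero = []
  block D c lo (suc d) = rowWord k D (suc (lo ℕ.+ d)) c ++ block D c lo d

  rowWord≡segment : ∀ D p d → rowWord k D p d ≡ segment D p 0 d
  rowWord≡segment D p zero = refl
  rowWord≡segment D p (suc d) = cong (cellLetter D p (suc d) ++_) (rowWord≡segment D p d)

  diagWord≡block : ∀ D c d → diagWord k D d c ≡ block D c 0 d
  diagWord≡block D c zero = refl
  diagWord≡block D c (suc d) = cong (rowWord k D (suc d) c ++_) (diagWord≡block D c d)

  segment-++ : ∀ D p lo d1 d2 →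
               segment D p lo (d1 ℕ.+ d2) ≡ segment D p (lo ℕ.+ d1) d2 ++ segment D p lo d1
  segment-++ D p lo d1 zero rewrite ℕP.+-identityʳ d1 = refl
  segment-++ D p lo d1 (suc d2) rewrite ℕP.+-suc d1 d2 | ℕP.+-assoc lo d1 d2 =
    trans (cong (cellLetter D p (suc (lo ℕ.+ (d1 ℕ.+ d2))) ++_) (segment-++ D p lo d1 d2))
          (sym (List.++-assoc (cellLetter D p (suc (lo ℕ.+ (d1 ℕ.+ d2)))) _ _))

  block-++ : ∀ D c lo d1 d2 → block D c lo (d1 ℕ.+ d2) ≡ block D c (lo ℕ.+ d1) d2 ++ block D c lo d1
  block-++ D c lo d1 zero rewrite ℕP.+-identityʳ d1 = refl
  block-++ D c lo d1 (suc d2) rewrite ℕP.+-suc d1 d2 | ℕP.+-assoc lo d1 d2 =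
    trans (cong (rowWord k D (suc (lo ℕ.+ (d1 ℕ.+ d2))) c ++_) (block-++ D c lo d1 d2))
          (sym (List.++-assoc (rowWord k D (suc (lo ℕ.+ (d1 ℕ.+ d2))) c) _ _))

  row-cong : ∀ D E p d → (∀ q → D p q ≡ E p q) → rowWord k D p d ≡ rowWord k E p d
  row-cong D E p zero    agree = refl
  row-cong D E p (suc d) agree rewrite agree (suc d) = cong (cellLetter E p (suc d) ++_) (row-cong D E p d agree)

  segment-cong : ∀ D E p lo d → (∀ q → lo < q → q ≤ lo ℕ.+ d → D p q ≡ E p q) →
                 segment D p lo d ≡ segment E p lo d
  segment-cong D E p lo zero    agree = refl
  segment-cong D E p lo (suc d) agree rewrite agree (suc (lo ℕ.+ d)) (lo<last lo d) (last≤ lo d) =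
    cong (cellLetter E p (suc (lo ℕ.+ d)) ++_)
      (segment-cong D E p lo d (λ q lo<q q≤ → agree q lo<q (≤-widen lo d q≤)))

  block-cong : ∀ D E c lo d → (∀ p q → lo < p → p ≤ lo ℕ.+ d → D p q ≡ E p q) →
               block D c lo d ≡ block E c lo d
  block-cong D E c lo zero    agree = refl
  block-cong D E c lo (suc d) agree = cong₂ _++_
    (row-cong D E (suc (lo ℕ.+ d)) c (λ q → agree _ q (lo<last lo d) (last≤ lo d)))
    (block-cong D E c lo d (λ p q lo<p p≤ → agree p q lo<p (≤-widen lo d p≤)))

  diagWord-cong : ∀ D E c M → (∀ p q → D p q ≡ E p q) → diagWord k D M c ≡ diagWord k E M c
  diagWord-cong D E c M agree = trans (diagWord≡block D c M)
    (trans (block-cong D E c 0 M (λ p q _ _ → agree p q)) (sym (diagWord≡block E c M)))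

  rowWord-split : ∀ D p c j → j ≤ c → rowWord k D p c ≡ segment D p j (c ∸ j) ++ segment D p 0 j
  rowWord-split D p c j j≤c = trans (rowWord≡segment D p c)
    (trans (cong (segment D p 0) (sym (ℕP.m+[n∸m]≡n j≤c))) (segment-++ D p 0 j (c ∸ j)))

  rowWord-at : ∀ D p c j → suc j ≤ c →
               rowWord k D p c ≡ segment D p (suc j) (c ∸ suc j) ++ cellLetter D p (suc j) ++ segment D p 0 j
  rowWord-at D p c j = rowWord-split D p c (suc j)

  cellLetter-true : ∀ D p q → D p q ≡ true → cellLetter D p q ≡ [ cellRes k p q ]
  cellLetter-true D p q Dpq rewrite Dpq = refl

  cellLetter-false : ∀ D p q → D p q ≡ false → cellLetter D p q ≡ []
  cellLetter-false D p q Dpq rewrite Dpq = refl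

module RowActions (k : ℕ) where
  open import Data.Integer using (_+_; _*_)
  open Residues k
  open Reflections k
  open Words k
  open ReadingWords k

  -- The letter of the cell (p , q) fixes y.
  Avoids : ℤ → ℕ → ℕ → Set
  Avoids y p q = res k y ≢ res k (+ q - + p) × res k y ≢ res k (+ q - + p + + 1)

  next-column : ∀ q p → + q - + p + + 1 ≡ + suc q - + p
  next-column q p = shift (+ q) (+ p)
    where
    shift : ∀ q p → (q - p) + + 1 ≡ (+ 1 + q) - p
    shift = solve-∀

  avoids-below : ∀ y a b p q → res k y ≡ res k (+ a - + b) →
                 suc q ℕ.+ b < a ℕ.+ p → a ℕ.+ p < q ℕ.+ b ℕ.+ suc k → Avoids y p q
  avoids-below y a b p q y≡ lower upper =
    (λ eq → res-diff-≢ q p a b (ℕP.<-trans (ℕP.n<1+n _) lower) upper (trans (sym eq) y≡)) ,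
    (λ eq → res-diff-≢ (suc q) p a b lower (ℕP.<-≤-trans upper (ℕP.+-monoˡ-≤ (suc k) (ℕP.n≤1+n _)))
              (trans (sym (trans eq (cong (res k) (next-column q p)))) y≡))

  avoids-above : ∀ y a b p q → res k y ≡ res k (+ a - + b) →
                 a ℕ.+ p < q ℕ.+ b → suc q ℕ.+ b < a ℕ.+ p ℕ.+ suc k → Avoids y p q
  avoids-above y a b p q y≡ lower upper =
    (λ eq → res-diff-≢ a b q p lower (ℕP.<-trans (ℕP.n<1+n _) upper) (trans (sym y≡) eq)) ,
    (λ eq → res-diff-≢ a b (suc q) p (ℕP.<-trans lower (ℕP.n<1+n _)) upper
              (trans (sym y≡) (trans eq (cong (res k) (next-column q p)))))

  letter-fix : ∀ D p q y → (D p q ≡ true → Avoids y p q) → evalWord k (cellLetter D p q) y ≡ y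
  letter-fix D p q y avoids with D p q
  ... | false = refl
  ... | true  = s-fix-res (+ q - + p) y (proj₁ (avoids refl)) (proj₂ (avoids refl))

  segment-fix : ∀ D p lo d y → (∀ q → lo < q → q ≤ lo ℕ.+ d → D p q ≡ true → Avoids y p q) →
                evalWord k (segment D p lo d) y ≡ y
  segment-fix D p lo zero    y avoids = refl
  segment-fix D p lo (suc d) y avoids = begin
    evalWord k (cellLetter D p q ++ segment D p lo d) y     ≡⟨ eval-++ (cellLetter D p q) _ y ⟩
    evalWord k (cellLetter D p q) (evalWord k (segment D p lo d) y)
      ≡⟨ cong (evalWord k (cellLetter D p q)) (segment-fix D p lo d y
           (λ q' lo<q' q'≤ → avoids q' lo<q' (≤-widen lo d q'≤))) ⟩
    evalWord k (cellLetter D p q) y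
      ≡⟨ letter-fix D p q y (avoids q (lo<last lo d) (last≤ lo d)) ⟩
    y                                                        ∎
    where
    open ≡-Reasoning
    q = suc (lo ℕ.+ d)

  segment-slide : ∀ D p lo d y → (∀ q → lo < q → q ≤ lo ℕ.+ d → D p q ≡ true) →
                  res k y ≡ res k (+ suc lo - + p) → evalWord k (segment D p lo d) y ≡ y + + d
  segment-slide D p lo zero    y present y≡ = sym (ℤP.+-identityʳ y)
  segment-slide D p lo (suc d) y present y≡ = begin
    evalWord k (cellLetter D p q ++ segment D p lo d) y     ≡⟨ eval-++ (cellLetter D p q) _ y ⟩
    evalWord k (cellLetter D p q) (evalWord k (segment D p lo d) y)
      ≡⟨ cong (evalWord k (cellLetter D p q)) (segment-slide D p lo d y
           (λ q' lo<q' q'≤ → present q' lo<q' (≤-widen lo d q'≤)) y≡) ⟩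
    evalWord k (cellLetter D p q) (y + + d)
      ≡⟨ cong (λ l → evalWord k l (y + + d)) (cellLetter-true D p q Dq) ⟩
    s k (cellRes k p q) (y + + d)                            ≡⟨ s-up-res (+ q - + p) (y + + d) y+d≡ ⟩
    y + + d + + 1                                            ≡⟨ assoc y (+ d) ⟩
    y + + suc d                                              ∎
    where
    open ≡-Reasoning
    q = suc (lo ℕ.+ d)
    Dq : D p q ≡ true
    Dq = present q (lo<last lo d) (last≤ lo d)
    assoc : ∀ y d → y + d + + 1 ≡ y + (+ 1 + d)
    assoc = solve-∀
    y+d≡ : res k (y + + d) ≡ res k (+ q - + p)
    y+d≡ = trans (res-shift y (+ suc lo - + p) y≡ (+ d)) (cong (res k) (shift (+ suc lo) (+ p) (+ d)))
      where
      shift : ∀ a b c → (a - b) + c ≡ (a + c) - b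
      shift = solve-∀

  row-fix : ∀ D p c y → (∀ q → 1 ≤ q → q ≤ c → D p q ≡ true → Avoids y p q) →
            evalWord k (rowWord k D p c) y ≡ y
  row-fix D p c y avoids rewrite rowWord≡segment D p c = segment-fix D p 0 c y avoids

  block-fix : ∀ D c lo d y →
              (∀ p q → lo < p → p ≤ lo ℕ.+ d → 1 ≤ q → q ≤ c → D p q ≡ true → Avoids y p q) →
              evalWord k (block D c lo d) y ≡ y
  block-fix D c lo zero    y avoids = refl
  block-fix D c lo (suc d) y avoids =
    trans (eval-++ (rowWord k D p c) _ y)
      (trans (cong (evalWord k (rowWord k D p c))
               (block-fix D c lo d y (λ p' q lo<p' p'≤ → avoids p' q lo<p' (≤-widen lo d p'≤))))
        (row-fix D p c y (λ q → avoids p q (lo<last lo d) (last≤ lo d))))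
    where
    p = suc (lo ℕ.+ d)

  module _ (1≤k : 1 ≤ k) where

    -- Only the letter of (p , j) touches y.
    row-down : ∀ D p c j y → 1 ≤ j → j ≤ c → c ≤ k → D p j ≡ true →
               res k y ≡ res k (+ suc j - + p) → evalWord k (rowWord k D p c) y ≡ y - + 1
    row-down D p c (suc j) y 1≤j j<c c≤k Dj y≡ = begin
      evalWord k (rowWord k D p c) y
        ≡⟨ cong (λ l → evalWord k l y) (rowWord-at D p c j j<c) ⟩
      evalWord k (right ++ cellLetter D p (suc j) ++ left) y
        ≡⟨ trans (eval-++ right _ y) (cong (evalWord k right) (eval-++ (cellLetter D p (suc j)) left y)) ⟩
      evalWord k right (evalWord k (cellLetter D p (suc j)) (evalWord k left y))
        ≡⟨ cong (λ z → evalWord k right (evalWord k (cellLetter D p (suc j)) z)) left-fixes ⟩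
      evalWord k right (evalWord k (cellLetter D p (suc j)) y)
        ≡⟨ cong (evalWord k right) letter-moves ⟩
      evalWord k right (y - + 1)
        ≡⟨ right-fixes ⟩
      y - + 1 ∎
      where
      open ≡-Reasoning
      right = segment D p (suc j) (c ∸ suc j)
      left = segment D p 0 j
      c≡ : suc j ℕ.+ (c ∸ suc j) ≡ c
      c≡ = ℕP.m+[n∸m]≡n j<c
      left-fixes : evalWord k left y ≡ y
      left-fixes = segment-fix D p 0 j y (λ q 0<q q≤j _ →
        avoids-below y (suc (suc j)) p p q y≡ (ℕP.+-monoˡ-< p (s≤s (s≤s q≤j)))
          (subst (suc (suc j) ℕ.+ p <_) ([x+y]+z≡[x+z]+y q (suc k) p) (ℕP.+-monoˡ-< p
            (ℕP.≤-trans (s≤s (s≤s (ℕP.≤-trans j<c c≤k)))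
              (subst (suc (suc k) ≤_) (ℕP.+-comm (suc k) q) (ℕP.m<m+n (suc k) 0<q))))))
      letter-moves : evalWord k (cellLetter D p (suc j)) y ≡ y - + 1
      letter-moves rewrite Dj =
        s-down-res 1≤k (+ suc j - + p) y (trans y≡ (cong (res k) (shift (+ suc j) (+ p))))
        where
        shift : ∀ j p → (+ 1 + j) - p ≡ (j - p) + + 1
        shift = solve-∀
      y-1≡ : res k (y - + 1) ≡ res k (+ suc j - + p)
      y-1≡ = trans (res-shift y (+ suc (suc j) - + p) y≡ (- + 1)) (cong (res k) (shift (+ suc j) (+ p)))
        where
        shift : ∀ j p → ((+ 1 + j) - p) - + 1 ≡ j - p
        shift = solve-∀
      right-fixes : evalWord k right (y - + 1) ≡ y - + 1
      right-fixes = segment-fix D p (suc j) (c ∸ suc j) (y - + 1) (λ q j<q q≤ _ →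
        avoids-above (y - + 1) (suc j) p p q y-1≡ (ℕP.+-monoˡ-< p j<q)
          (subst (suc q ℕ.+ p <_) ([x+y]+z≡[x+z]+y (suc j) (suc k) p) (ℕP.+-monoˡ-< p
            (ℕP.≤-<-trans (s≤s (ℕP.≤-trans (subst (q ≤_) c≡ q≤) c≤k)) (ℕP.m<n+m (suc k) (s≤s z≤n))))))

    block-down : ∀ D c lo d j y → 1 ≤ j → j ≤ c → c ≤ k →
                 (∀ p → lo < p → p ≤ lo ℕ.+ d → D p j ≡ true) →
                 res k y ≡ res k (+ j - + lo) → evalWord k (block D c lo d) y ≡ y - + d
    block-down D c lo zero    j y 1≤j j≤c c≤k present y≡ = sym (ℤP.+-identityʳ y)
    block-down D c lo (suc d) j y 1≤j j≤c c≤k present y≡ = begin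
      evalWord k (rowWord k D p c ++ block D c lo d) y       ≡⟨ eval-++ (rowWord k D p c) _ y ⟩
      evalWord k (rowWord k D p c) (evalWord k (block D c lo d) y)
        ≡⟨ cong (evalWord k (rowWord k D p c)) (block-down D c lo d j y 1≤j j≤c c≤k
             (λ p' lo<p' p'≤ → present p' lo<p' (≤-widen lo d p'≤)) y≡) ⟩
      evalWord k (rowWord k D p c) (y - + d)
        ≡⟨ row-down D p c j (y - + d) 1≤j j≤c c≤k
             (present p (lo<last lo d) (last≤ lo d))
             (trans (res-shift y (+ j - + lo) y≡ (- + d)) (cong (res k) (shift₁ (+ j) (+ lo) (+ d)))) ⟩
      y - + d - + 1                                           ≡⟨ shift₂ y (+ d) ⟩
      y - + suc d                                             ∎
      where
      open ≡-Reasoning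
      p = suc (lo ℕ.+ d)
      shift₁ : ∀ j lo d → (j - lo) - d ≡ (+ 1 + j) - (+ 1 + (lo + d))
      shift₁ = solve-∀
      shift₂ : ∀ y d → (y - d) - + 1 ≡ y - (+ 1 + d)
      shift₂ = solve-∀

module WordLengths (k : ℕ) where
  open ReadingWords k

  length-rowWord : ∀ D p Q → length (rowWord k D p Q) ≡ sumℕ (λ q → indicator (D p q)) Q
  length-rowWord D p zero    = refl
  length-rowWord D p (suc Q) = trans (List.length-++ (cellLetter D p (suc Q)))
    (trans (ℕP.+-comm (length (cellLetter D p (suc Q))) _)
      (cong₂ ℕ._+_ (length-rowWord D p Q) (length-cellLetter (D p (suc Q)))))
    where
    length-cellLetter : ∀ b → length (if b then [ cellRes k p (suc Q) ] else []) ≡ indicator b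
    length-cellLetter true  = refl
    length-cellLetter false = refl

  length-diagWord : ∀ D M c → length (diagWord k D M c) ≡ sumℕ (λ p → length (rowWord k D p c)) M
  length-diagWord D zero    c = refl
  length-diagWord D (suc M) c = trans (List.length-++ (rowWord k D (suc M) c))
    (trans (ℕP.+-comm (length (rowWord k D (suc M) c)) _)
      (cong (ℕ._+ length (rowWord k D (suc M) c)) (length-diagWord D M c)))

  length-diagWord-remove : ∀ D E M c zp zq → 1 ≤ zp → zp ≤ M → 1 ≤ zq → zq ≤ c →
    (∀ p q → (p , q) ≢ (zp , zq) → D p q ≡ E p q) → D zp zq ≡ true → E zp zq ≡ false →
    length (diagWord k D M c) ≡ suc (length (diagWord k E M c))
  length-diagWord-remove D E M c zp zq 1≤zp zp≤M 1≤zq zq≤c agree Dz Ez = begin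
    length (diagWord k D M c)                          ≡⟨ length-diagWord D M c ⟩
    sumℕ (λ p → length (rowWord k D p c)) M            ≡⟨ sum-update _ _ M zp 1≤zp zp≤M other-rows removed-row ⟩
    suc (sumℕ (λ p → length (rowWord k E p c)) M)      ≡⟨ cong suc (sym (length-diagWord E M c)) ⟩
    suc (length (diagWord k E M c))                    ∎
    where
    open ≡-Reasoning
    other-rows : ∀ p → p ≢ zp → length (rowWord k D p c) ≡ length (rowWord k E p c)
    other-rows p p≢zp = cong length (row-cong D E p c (λ q → agree p q (≢-row p≢zp)))
    removed-row : length (rowWord k D zp c) ≡ suc (length (rowWord k E zp c))
    removed-row = trans (length-rowWord D zp c) (trans
      (sum-update _ _ c zq 1≤zq zq≤c (λ q q≢zq → cong indicator (agree zp q (≢-col q≢zq)))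
        (trans (cong indicator Dz) (sym (cong (suc ∘ indicator) Ez))))
      (cong suc (sym (length-rowWord E zp c))))

module Shape (k c : ℕ) (c≤k : c ≤ k) (lam : ℕ → ℕ) (partition : IsPartitionIn k c lam) where
  open import Data.Integer using (_+_; _*_)
  open Residues k
  open Words k
  open Potential k
  open ReadingWords k
  open RowActions k

  rows : ℕ
  rows = suc k ∸ c

  c+rows≡N : c ℕ.+ rows ≡ suc k
  c+rows≡N = ℕP.m+[n∸m]≡n (ℕP.m≤n⇒m≤1+n c≤k)

  lam-antitone : ∀ p p' → 1 ≤ p → p ≤ p' → lam p' ≤ lam p
  lam-antitone p p' 1≤p p≤p' = subst (λ z → lam z ≤ lam p) (ℕP.m+[n∸m]≡n p≤p') (go p (p' ∸ p) 1≤p)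
    where
    go : ∀ p d → 1 ≤ p → lam (p ℕ.+ d) ≤ lam p
    go p       zero    _   rewrite ℕP.+-identityʳ p = ℕP.≤-refl
    go (suc p) (suc d) 1≤p rewrite ℕP.+-suc p d =
      ℕP.≤-trans (proj₁ partition (p ℕ.+ d)) (go (suc p) d 1≤p)

  lam≤c : ∀ p → 1 ≤ p → lam p ≤ c
  lam≤c p 1≤p = ℕP.≤-trans (lam-antitone 1 p ℕP.≤-refl 1≤p) (proj₁ (proj₂ partition))

  nonempty⇒≤rows : ∀ p → 1 ≤ lam p → p ≤ rows
  nonempty⇒≤rows p 1≤lam =
    ℕP.≮⇒≥ (λ rows<p → ℕP.<-irrefl (sym (proj₂ (proj₂ partition) p rows<p)) 1≤lam)

  λᵇ : Diagram
  λᵇ = inShapeᵇ lam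

  shapeWord : List ℕ
  shapeWord = diagWord k λᵇ rows c

  row-slides : ∀ p → 1 ≤ p → evalWord k (rowWord k λᵇ p c) (rowEntry p) ≡ rowEntry p + + lam p
  row-slides p 1≤p = begin
    evalWord k (rowWord k λᵇ p c) y
      ≡⟨ cong (λ l → evalWord k l y) (rowWord-split λᵇ p c (lam p) (lam≤c p 1≤p)) ⟩
    evalWord k (absent ++ present) y                  ≡⟨ eval-++ absent present y ⟩
    evalWord k absent (evalWord k present y)
      ≡⟨ cong (evalWord k absent) (segment-slide λᵇ p 0 (lam p) y
           (λ q 0<q q≤ → inShapeᵇ-complete lam p q (1≤p , 0<q , q≤)) y≡) ⟩
    evalWord k absent (y + + lam p)
      ≡⟨ segment-fix λᵇ p (lam p) (c ∸ lam p) (y + + lam p) (λ q lp<q _ inλ →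
           ⊥-elim (ℕP.<⇒≱ lp<q (proj₂ (proj₂ (inShapeᵇ-sound lam p q inλ))))) ⟩
    y + + lam p ∎
    where
    open ≡-Reasoning
    y = rowEntry p
    present = segment λᵇ p 0 (lam p)
    absent = segment λᵇ p (lam p) (c ∸ lam p)
    y≡ : res k y ≡ res k (+ 1 - + p)
    y≡ = trans (cong (res k) (shift (+ suc k) (+ p))) (res-periodic (+ 1 - + p) (+ 1))
      where
      shift : ∀ N p → (+ 1 + N) - p ≡ (+ 1 - p) + + 1 * N
      shift = solve-∀

  rows-above-fix : ∀ p-1 → suc p-1 ≤ rows →
                   evalWord k (block λᵇ c 0 p-1) (rowEntry (suc p-1)) ≡ rowEntry (suc p-1)
  rows-above-fix p-1 p≤rows = block-fix λᵇ c 0 p-1 (rowEntry p) (λ p' q 0<p' p'≤ 1≤q q≤c _ →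
    avoids-below (rowEntry p) (suc (suc k)) p p' q refl
      (ℕP.≤-<-trans (s≤s (subst (q ℕ.+ p ≤_) c+rows≡N (ℕP.+-mono-≤ q≤c p≤rows))) (ℕP.m<m+n (suc (suc k)) 0<p'))
      (subst₂ _<_ (ℕP.+-suc (suc k) p') (ℕP.+-comm (suc k) (q ℕ.+ p))
        (ℕP.+-monoʳ-< (suc k) (ℕP.≤-<-trans (s≤s p'≤) (ℕP.m<n+m p 1≤q)))))
    where
    p = suc p-1

  -- The rows below p are no longer than row p.
  rows-below-fix : ∀ p → 1 ≤ p → p ≤ rows →
                   evalWord k (block λᵇ c p (rows ∸ p)) (rowEntry p + + lam p) ≡ rowEntry p + + lam p
  rows-below-fix p 1≤p p≤rows = block-fix λᵇ c p (rows ∸ p) y (λ p' q p<p' p'≤ 1≤q q≤c inλ →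
    let q≤lp = ℕP.≤-trans (proj₂ (proj₂ (inShapeᵇ-sound lam p' q inλ))) (lam-antitone p p' 1≤p (ℕP.<⇒≤ p<p'))
        p'≤rows = subst (p' ≤_) (ℕP.m+[n∸m]≡n p≤rows) p'≤
    in avoids-below y (suc (lam p)) p p' q y≡
         (ℕP.+-mono-≤-< (s≤s q≤lp) p<p')
         (ℕP.≤-<-trans (s≤s (subst (lam p ℕ.+ p' ≤_) c+rows≡N (ℕP.+-mono-≤ (lam≤c p 1≤p) p'≤rows)))
           (subst (suc (suc k) <_) (ℕP.+-comm (suc k) (q ℕ.+ p))
             (subst (_≤ suc k ℕ.+ (q ℕ.+ p)) (ℕP.+-comm (suc k) 2)
               (ℕP.+-monoʳ-≤ (suc k) (ℕP.+-mono-≤ 1≤q 1≤p))))))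
    where
    y = rowEntry p + + lam p
    y≡ : res k y ≡ res k (+ suc (lam p) - + p)
    y≡ = trans (cong (res k) (shift (+ suc k) (+ p) (+ lam p))) (res-periodic (+ suc (lam p) - + p) (+ 1))
      where
      shift : ∀ N p l → ((+ 1 + N) - p) + l ≡ ((+ 1 + l) - p) + + 1 * N
      shift = solve-∀

  shapeWord-rowEntry : ∀ p → 1 ≤ p → p ≤ rows → evalWord k shapeWord (rowEntry p) ≡ rowEntry p + + lam p
  shapeWord-rowEntry (suc p-1) 1≤p p≤rows = begin
    evalWord k shapeWord y
      ≡⟨ cong (λ l → evalWord k l y) (trans (diagWord≡block λᵇ c rows)
           (trans (cong (block λᵇ c 0) (sym (ℕP.m+[n∸m]≡n p≤rows))) (block-++ λᵇ c 0 p (rows ∸ p)))) ⟩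
    evalWord k (below ++ (rowWord k λᵇ p c ++ above)) y
      ≡⟨ trans (eval-++ below _ y) (cong (evalWord k below) (eval-++ (rowWord k λᵇ p c) above y)) ⟩
    evalWord k below (evalWord k (rowWord k λᵇ p c) (evalWord k above y))
      ≡⟨ cong (λ z → evalWord k below (evalWord k (rowWord k λᵇ p c) z)) (rows-above-fix p-1 p≤rows) ⟩
    evalWord k below (evalWord k (rowWord k λᵇ p c) y)
      ≡⟨ cong (evalWord k below) (row-slides p 1≤p) ⟩
    evalWord k below (y + + lam p)
      ≡⟨ rows-below-fix p 1≤p p≤rows ⟩
    y + + lam p ∎
    where
    open ≡-Reasoning
    p = suc p-1
    y = rowEntry p
    above = block λᵇ c 0 p-1
    below = block λᵇ c p (rows ∸ p)

  size≤potential : sumℕ lam rows ≤ potential (evalWord k shapeWord)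
  size≤potential = ℕP.≤-trans (ℕP.≤-reflexive (sum-cong _ _ rows displacement))
    (sum-prefix-≤ _ rows (suc k) (subst (rows ≤_) c+rows≡N (ℕP.m≤n+m rows c)))
    where
    cancel : ∀ y l → (y + l) - y ≡ l
    cancel = solve-∀
    displacement : ∀ p → 1 ≤ p → p ≤ rows → lam p ≡ posPart (evalWord k shapeWord (rowEntry p) - rowEntry p)
    displacement p 1≤p p≤rows = sym (cong posPart
      (trans (cong (_- rowEntry p) (shapeWord-rowEntry p 1≤p p≤rows)) (cancel (rowEntry p) (+ lam p))))

  open WordLengths k

  length-shapeRow : ∀ p Q → 1 ≤ p → length (rowWord k λᵇ p Q) ≡ Q ℕ.⊓ lam p
  length-shapeRow p zero    _   = refl
  length-shapeRow (suc p) (suc Q) 1≤p with suc Q ℕP.≤? lam (suc p)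
  ... | yes Q<lp rewrite dec-true (suc Q ℕP.≤? lam (suc p)) Q<lp =
    trans (cong suc (trans (length-shapeRow (suc p) Q 1≤p) (ℕP.m≤n⇒m⊓n≡m (ℕP.<⇒≤ Q<lp))))
          (sym (ℕP.m≤n⇒m⊓n≡m Q<lp))
  ... | no  Q≮lp rewrite dec-false (suc Q ℕP.≤? lam (suc p)) Q≮lp =
    trans (length-shapeRow (suc p) Q 1≤p)
          (trans (ℕP.m≥n⇒m⊓n≡n lp≤Q) (sym (ℕP.m≥n⇒m⊓n≡n (ℕP.m≤n⇒m≤1+n lp≤Q))))
    where
    lp≤Q = ℕP.≤-pred (ℕP.≰⇒> Q≮lp)

  length-shapeWord : length shapeWord ≡ sumℕ lam rows
  length-shapeWord = trans (length-diagWord λᵇ rows c) (sum-cong _ _ rows (λ p 1≤p _ →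
    trans (length-shapeRow p c 1≤p) (ℕP.m≥n⇒m⊓n≡n (lam≤c p 1≤p))))

  minusᵇ : List Cell → Diagram
  minusᵇ Y p q = inShapeᵇ lam p q ∧ not (memᵇ p q Y)

  minusᵇ-∷ : ∀ zp zq Y p q → (p , q) ≢ (zp , zq) → minusᵇ ((zp , zq) ∷ Y) p q ≡ minusᵇ Y p q
  minusᵇ-∷ zp zq Y p q p,q≢z with p ℕP.≟ zp
  ... | no p≢zp rewrite ≡ᵇ-false p≢zp = refl
  ... | yes refl rewrite ≡ᵇ-true {p} refl | ≡ᵇ-false (p,q≢z ∘ cong (p ,_)) = refl

  ∈⇒minusᵇ-false : ∀ Y p q → (p , q) ∈ Y → minusᵇ Y p q ≡ false
  ∈⇒minusᵇ-false Y p q p,q∈Y rewrite ∈⇒memᵇ p q Y p,q∈Y = Bool.∧-zeroʳ _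

  minusᵇ-true : ∀ Y p q → InShape lam (p , q) → (p , q) ∉ Y → minusᵇ Y p q ≡ true
  minusᵇ-true Y p q inλ ∉Y rewrite inShapeᵇ-complete lam p q inλ | ∉⇒memᵇ p q Y ∉Y = refl

  length-minus : ∀ Y → Unique Y → All (InShape lam) Y →
                 length shapeWord ≡ length (diagWord k (minusᵇ Y) rows c) ℕ.+ length Y
  length-minus [] _ _ =
    trans (cong length (diagWord-cong λᵇ (minusᵇ []) c rows (λ p q → sym (Bool.∧-identityʳ _))))
          (sym (ℕP.+-identityʳ _))
  length-minus ((zp , zq) ∷ Y) (z∉Y ∷ unique) (z∈λ@(1≤zp , 1≤zq , zq≤) ∷ inλ) =
    trans (length-minus Y unique inλ) (trans (cong (ℕ._+ length Y) removal) (sym (ℕP.+-suc _ _)))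
    where
    removal : length (diagWord k (minusᵇ Y) rows c) ≡ suc (length (diagWord k (minusᵇ ((zp , zq) ∷ Y)) rows c))
    removal = length-diagWord-remove _ _ rows c zp zq 1≤zp (nonempty⇒≤rows zp (ℕP.≤-trans 1≤zq zq≤))
      1≤zq (ℕP.≤-trans zq≤ (lam≤c zp 1≤zp)) (λ p q ne → sym (minusᵇ-∷ zp zq Y p q ne))
      (minusᵇ-true Y zp zq z∈λ (λ z∈Y → All.lookup z∉Y z∈Y refl))
      (∈⇒minusᵇ-false ((zp , zq) ∷ Y) zp zq (here refl))

module Deletion (k c : ℕ) (1≤k : 1 ≤ k) (c≤k : c ≤ k) (lam : ℕ → ℕ) (partition : IsPartitionIn k c lam)
  (X : List Cell) (ia-1 ja-1 ib-1 jb-1 : ℕ)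
  (xa∈X : (suc ia-1 , suc ja-1) ∈ X) (xb∈X : (suc ib-1 , suc jb-1) ∈ X)
  (ib<ia : suc ib-1 < suc ia-1) (ja<jb : suc ja-1 < suc jb-1) (corner∈λ : InShape lam (suc ia-1 , suc jb-1))
  (rect-free : ∀ x → x ∈ X → x ≢ (suc ia-1 , suc ja-1) → x ≢ (suc ib-1 , suc jb-1) →
               ¬ InRect (suc ia-1 , suc ja-1) (suc ib-1 , suc jb-1) x)
  where
  open import Data.Integer using (_+_; _*_)
  open Residues k
  open Words k
  open ReadingWords k
  open RowActions k
  open Conjugation k 1≤k
  open Shape k c c≤k lam partition

  ia = suc ia-1
  ja = suc ja-1
  ib = suc ib-1
  jb = suc jb-1

  -- E also omits the two free corners (ia , jb) and (ib , ja) of the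
  -- rectangle; their letters x and y in the reading word of D cancel.
  D E : Diagram
  D = minusᵇ X
  E = minusᵇ ((ia , jb) ∷ (ib , ja) ∷ X)

  x y : ℕ
  x = cellRes k ia jb
  y = cellRes k ib ja

  jb≤lam : jb ≤ lam ia
  jb≤lam = proj₂ (proj₂ corner∈λ)

  ia≤rows : ia ≤ rows
  ia≤rows = nonempty⇒≤rows ia (ℕP.≤-trans (s≤s z≤n) jb≤lam)

  jb≤c : jb ≤ c
  jb≤c = ℕP.≤-trans jb≤lam (lam≤c ia (s≤s z≤n))

  ja≤c : ja ≤ c
  ja≤c = ℕP.≤-trans (ℕP.<⇒≤ ja<jb) jb≤c

  ib≤ia-1 : ib ≤ ia-1
  ib≤ia-1 = ℕP.≤-pred ib<ia

  D≡E : ∀ p q → (p , q) ≢ (ia , jb) → (p , q) ≢ (ib , ja) → D p q ≡ E p q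
  D≡E p q ≢₁ ≢₂ = sym (trans (minusᵇ-∷ ia jb ((ib , ja) ∷ X) p q ≢₁) (minusᵇ-∷ ib ja X p q ≢₂))

  rectangle-inShape : ∀ p q → InRect (ia , ja) (ib , jb) (p , q) → InShape lam (p , q)
  rectangle-inShape p q (ib≤p , p≤ia , ja≤q , q≤jb) =
    ℕP.≤-trans (s≤s z≤n) ib≤p , ℕP.≤-trans (s≤s z≤n) ja≤q ,
    ℕP.≤-trans q≤jb (ℕP.≤-trans jb≤lam (lam-antitone p ia (ℕP.≤-trans (s≤s z≤n) ib≤p) p≤ia))

  D-rectangle : ∀ p q → InRect (ia , ja) (ib , jb) (p , q) →
                (p , q) ≢ (ia , ja) → (p , q) ≢ (ib , jb) → D p q ≡ true
  D-rectangle p q inR ≢a ≢b =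
    minusᵇ-true X p q (rectangle-inShape p q inR) (λ p,q∈X → rect-free (p , q) p,q∈X ≢a ≢b inR)

  E-rectangle : ∀ p q → InRect (ia , ja) (ib , jb) (p , q) → (p , q) ≢ (ia , ja) → (p , q) ≢ (ib , jb) →
                (p , q) ≢ (ia , jb) → (p , q) ≢ (ib , ja) → E p q ≡ true
  E-rectangle p q inR ≢a ≢b ≢₁ ≢₂ = trans (sym (D≡E p q ≢₁ ≢₂)) (D-rectangle p q inR ≢a ≢b)

  ia≢ib : ia ≢ ib
  ia≢ib = ℕP.>⇒≢ ib<ia

  ja≢jb : ja ≢ jb
  ja≢jb = ℕP.<⇒≢ ja<jb

  D-corner₁ : D ia jb ≡ true
  D-corner₁ = D-rectangle ia jb (ℕP.<⇒≤ ib<ia , ℕP.≤-refl , ℕP.<⇒≤ ja<jb , ℕP.≤-refl)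
    (≢-col (ja≢jb ∘ sym)) (≢-row ia≢ib)

  D-corner₂ : D ib ja ≡ true
  D-corner₂ = D-rectangle ib ja (ℕP.≤-refl , ℕP.<⇒≤ ib<ia , ℕP.≤-refl , ℕP.<⇒≤ ja<jb)
    (≢-row (ia≢ib ∘ sym)) (≢-col ja≢jb)

  E-corner₁ : E ia jb ≡ false
  E-corner₁ = ∈⇒minusᵇ-false ((ia , jb) ∷ (ib , ja) ∷ X) ia jb (here refl)

  E-corner₂ : E ib ja ≡ false
  E-corner₂ = ∈⇒minusᵇ-false ((ia , jb) ∷ (ib , ja) ∷ X) ib ja (there (here refl))

  below rightOf₁ leftOf₁ between rightOf₂ leftOf₂ above inner : List ℕ
  below    = block E c ia (rows ∸ ia)
  rightOf₁ = segment E ia jb (c ∸ jb)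
  leftOf₁  = segment E ia 0 jb-1
  between  = block E c ib (ia-1 ∸ ib)
  rightOf₂ = segment E ib ja (c ∸ ja)
  leftOf₂  = segment E ib 0 ja-1
  above    = block E c 0 ib-1
  inner    = leftOf₁ ++ between ++ rightOf₂

  diagWord-around : ∀ F → diagWord k F rows c ≡
    block F c ia (rows ∸ ia) ++
      (rowWord k F ia c ++ (block F c ib (ia-1 ∸ ib) ++ (rowWord k F ib c ++ block F c 0 ib-1)))
  diagWord-around F = begin
    diagWord k F rows c                                     ≡⟨ diagWord≡block F c rows ⟩
    block F c 0 rows                                        ≡⟨ cong (block F c 0) (sym (ℕP.m+[n∸m]≡n ia≤rows)) ⟩
    block F c 0 (ia ℕ.+ (rows ∸ ia))                        ≡⟨ block-++ F c 0 ia (rows ∸ ia) ⟩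
    block F c ia (rows ∸ ia) ++ rowWord k F ia c ++ block F c 0 ia-1
      ≡⟨ cong (λ l → block F c ia (rows ∸ ia) ++ rowWord k F ia c ++ l)
           (trans (cong (block F c 0) (sym (ℕP.m+[n∸m]≡n ib≤ia-1))) (block-++ F c 0 ib (ia-1 ∸ ib))) ⟩
    block F c ia (rows ∸ ia) ++
      (rowWord k F ia c ++ (block F c ib (ia-1 ∸ ib) ++ (rowWord k F ib c ++ block F c 0 ib-1))) ∎
    where open ≡-Reasoning

  word-E : diagWord k E rows c ≡ (below ++ rightOf₁) ++ inner ++ leftOf₂ ++ above
  word-E = begin
    diagWord k E rows c                                     ≡⟨ diagWord-around E ⟩
    below ++ (rowWord k E ia c ++ (between ++ (rowWord k E ib c ++ above)))
      ≡⟨ cong₂ (λ r₁ r₂ → below ++ (r₁ ++ (between ++ (r₂ ++ above))))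
           (trans (rowWord-at E ia c jb-1 jb≤c)
             (cong (λ l → rightOf₁ ++ l ++ leftOf₁) (cellLetter-false E ia jb E-corner₁)))
           (trans (rowWord-at E ib c ja-1 ja≤c)
             (cong (λ l → rightOf₂ ++ l ++ leftOf₂) (cellLetter-false E ib ja E-corner₂))) ⟩
    below ++ ((rightOf₁ ++ [] ++ leftOf₁) ++ (between ++ ((rightOf₂ ++ [] ++ leftOf₂) ++ above)))
      ≡⟨ reassociate below rightOf₁ [] leftOf₁ between rightOf₂ [] leftOf₂ above ⟩
    (below ++ rightOf₁) ++ inner ++ leftOf₂ ++ above        ∎
    where open ≡-Reasoning

  D≡E-off-rows : ∀ p q → p ≢ ia → p ≢ ib → D p q ≡ E p q
  D≡E-off-rows p q p≢ia p≢ib = D≡E p q (≢-row p≢ia) (≢-row p≢ib)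

  D≡E-row₁ : ∀ q → q ≢ jb → D ia q ≡ E ia q
  D≡E-row₁ q q≢jb = D≡E ia q (≢-col q≢jb) (≢-row ia≢ib)

  D≡E-row₂ : ∀ q → q ≢ ja → D ib q ≡ E ib q
  D≡E-row₂ q q≢ja = D≡E ib q (≢-row (ia≢ib ∘ sym)) (≢-col q≢ja)

  row-between : ∀ p → p ≤ ib ℕ.+ (ia-1 ∸ ib) → p < ia
  row-between p p≤ = s≤s (subst (p ≤_) (ℕP.m+[n∸m]≡n ib≤ia-1) p≤)

  word-D : diagWord k D rows c ≡ (below ++ rightOf₁) ++ x ∷ inner ++ y ∷ leftOf₂ ++ above
  word-D = begin
    diagWord k D rows c                                     ≡⟨ diagWord-around D ⟩
    below′ ++ (rowWord k D ia c ++ (between′ ++ (rowWord k D ib c ++ above′)))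
      ≡⟨ cong₂ (λ r₁ r₂ → below′ ++ (r₁ ++ (between′ ++ (r₂ ++ above′))))
           (trans (rowWord-at D ia c jb-1 jb≤c)
             (cong (λ l → rightOf₁′ ++ l ++ leftOf₁′) (cellLetter-true D ia jb D-corner₁)))
           (trans (rowWord-at D ib c ja-1 ja≤c)
             (cong (λ l → rightOf₂′ ++ l ++ leftOf₂′) (cellLetter-true D ib ja D-corner₂))) ⟩
    below′ ++ ((rightOf₁′ ++ [ x ] ++ leftOf₁′) ++
      (between′ ++ ((rightOf₂′ ++ [ y ] ++ leftOf₂′) ++ above′)))
      ≡⟨ reassociate below′ rightOf₁′ [ x ] leftOf₁′ between′ rightOf₂′ [ y ] leftOf₂′ above′ ⟩
    (below′ ++ rightOf₁′) ++ x ∷ (leftOf₁′ ++ between′ ++ rightOf₂′) ++ y ∷ leftOf₂′ ++ above′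
      ≡⟨ cong₂ (λ u l → u ++ x ∷ l) (cong₂ _++_ below≡ rightOf₁≡)
           (cong₂ (λ m l → m ++ y ∷ l) (cong₂ _++_ leftOf₁≡ (cong₂ _++_ between≡ rightOf₂≡))
             (cong₂ _++_ leftOf₂≡ above≡)) ⟩
    (below ++ rightOf₁) ++ x ∷ inner ++ y ∷ leftOf₂ ++ above ∎
    where
    open ≡-Reasoning
    below′    = block D c ia (rows ∸ ia)
    rightOf₁′ = segment D ia jb (c ∸ jb)
    leftOf₁′  = segment D ia 0 jb-1
    between′  = block D c ib (ia-1 ∸ ib)
    rightOf₂′ = segment D ib ja (c ∸ ja)
    leftOf₂′  = segment D ib 0 ja-1
    above′    = block D c 0 ib-1
    below≡ : below′ ≡ below
    below≡ = block-cong D E c ia (rows ∸ ia) (λ p q ia<p _ →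
      D≡E-off-rows p q (ℕP.>⇒≢ ia<p) (ℕP.>⇒≢ (ℕP.<-trans ib<ia ia<p)))
    rightOf₁≡ : rightOf₁′ ≡ rightOf₁
    rightOf₁≡ = segment-cong D E ia jb (c ∸ jb) (λ q jb<q _ → D≡E-row₁ q (ℕP.>⇒≢ jb<q))
    leftOf₁≡ : leftOf₁′ ≡ leftOf₁
    leftOf₁≡ = segment-cong D E ia 0 jb-1 (λ q _ q≤ → D≡E-row₁ q (ℕP.<⇒≢ (s≤s q≤)))
    between≡ : between′ ≡ between
    between≡ = block-cong D E c ib (ia-1 ∸ ib) (λ p q ib<p p≤ →
      D≡E-off-rows p q (ℕP.<⇒≢ (row-between p p≤)) (ℕP.>⇒≢ ib<p))
    rightOf₂≡ : rightOf₂′ ≡ rightOf₂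
    rightOf₂≡ = segment-cong D E ib ja (c ∸ ja) (λ q ja<q _ → D≡E-row₂ q (ℕP.>⇒≢ ja<q))
    leftOf₂≡ : leftOf₂′ ≡ leftOf₂
    leftOf₂≡ = segment-cong D E ib 0 ja-1 (λ q _ q≤ → D≡E-row₂ q (ℕP.<⇒≢ (s≤s q≤)))
    above≡ : above′ ≡ above
    above≡ = block-cong D E c 0 ib-1 (λ p q _ p≤ →
      D≡E-off-rows p q (ℕP.<⇒≢ (ℕP.<-trans (s≤s p≤) ib<ia)) (ℕP.<⇒≢ (s≤s p≤)))

  within-period : ∀ q a b → q ≤ k → 1 ≤ a → suc q ℕ.+ b < a ℕ.+ b ℕ.+ suc k
  within-period q a b q≤k 1≤a = subst (suc q ℕ.+ b <_) ([x+y]+z≡[x+z]+y a (suc k) b)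
    (ℕP.+-monoˡ-< b (ℕP.≤-<-trans (s≤s q≤k) (ℕP.m<n+m (suc k) 1≤a)))

  v u : ℤ
  v = + ja - + ib
  u = + jb - + ia

  d d₁ : ℕ
  d  = ia-1 ∸ ib
  d₁ = jb-1 ∸ ja

  ja+d₁≡ : ja ℕ.+ d₁ ≡ jb-1
  ja+d₁≡ = ℕP.m+[n∸m]≡n (ℕP.≤-pred ja<jb)

  E-xa : E ia ja ≡ false
  E-xa = ∈⇒minusᵇ-false ((ia , jb) ∷ (ib , ja) ∷ X) ia ja (there (there xa∈X))

  E-xb : E ib jb ≡ false
  E-xb = ∈⇒minusᵇ-false ((ia , jb) ∷ (ib , ja) ∷ X) ib jb (there (there xb∈X))

  E-row₁-interior : ∀ q → ja < q → q ≤ ja ℕ.+ d₁ → E ia q ≡ true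
  E-row₁-interior q ja<q q≤ =
    E-rectangle ia q (ℕP.<⇒≤ ib<ia , ℕP.≤-refl , ℕP.<⇒≤ ja<q , ℕP.m≤n⇒m≤1+n q≤jb-1)
      (≢-col (ℕP.>⇒≢ ja<q)) (≢-row ia≢ib) (≢-col (ℕP.<⇒≢ (s≤s q≤jb-1))) (≢-row ia≢ib)
    where q≤jb-1 = subst (q ≤_) ja+d₁≡ q≤

  E-row₂-interior : ∀ q → ja < q → q ≤ ja ℕ.+ d₁ → E ib q ≡ true
  E-row₂-interior q ja<q q≤ =
    E-rectangle ib q (ℕP.≤-refl , ℕP.<⇒≤ ib<ia , ℕP.<⇒≤ ja<q , ℕP.m≤n⇒m≤1+n q≤jb-1)
      (≢-row (ia≢ib ∘ sym)) (≢-col (ℕP.<⇒≢ (s≤s q≤jb-1))) (≢-row (ia≢ib ∘ sym)) (≢-col (ℕP.>⇒≢ ja<q))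
    where q≤jb-1 = subst (q ≤_) ja+d₁≡ q≤

  rightOf₂-fixes-v : evalWord k rightOf₂ v ≡ v
  rightOf₂-fixes-v = segment-fix E ib ja (c ∸ ja) v (λ q ja<q q≤ _ →
    avoids-above v ja ib ib q refl (ℕP.+-monoˡ-< ib ja<q)
      (within-period q ja ib (ℕP.≤-trans (subst (q ≤_) (ℕP.m+[n∸m]≡n ja≤c) q≤) c≤k) (s≤s z≤n)))

  rightOf₂-slides-v+1 : evalWord k rightOf₂ (v + + 1) ≡ + jb - + ib
  rightOf₂-slides-v+1 = begin
    evalWord k rightOf₂ (v + + 1)
      ≡⟨ cong (λ l → evalWord k l (v + + 1))
           (trans (cong (segment E ib ja) c∸ja≡) (segment-++ E ib ja d₁ (c ∸ jb-1))) ⟩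
    evalWord k (segment E ib (ja ℕ.+ d₁) (c ∸ jb-1) ++ segment E ib ja d₁) (v + + 1)
      ≡⟨ eval-++ (segment E ib (ja ℕ.+ d₁) (c ∸ jb-1)) _ (v + + 1) ⟩
    evalWord k (segment E ib (ja ℕ.+ d₁) (c ∸ jb-1)) (evalWord k (segment E ib ja d₁) (v + + 1))
      ≡⟨ cong (evalWord k (segment E ib (ja ℕ.+ d₁) (c ∸ jb-1))) slide ⟩
    evalWord k (segment E ib (ja ℕ.+ d₁) (c ∸ jb-1)) (+ jb - + ib)
      ≡⟨ segment-fix E ib (ja ℕ.+ d₁) (c ∸ jb-1) (+ jb - + ib) (λ q lo<q q≤ Eq →
           right-of-xb q (subst (_< q) ja+d₁≡ lo<q)
             (subst (q ≤_) (trans (cong (ℕ._+ (c ∸ jb-1)) ja+d₁≡) (ℕP.m+[n∸m]≡n (ℕP.<⇒≤ jb≤c))) q≤) Eq) ⟩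
    + jb - + ib ∎
    where
    open ≡-Reasoning
    c∸ja≡ : c ∸ ja ≡ d₁ ℕ.+ (c ∸ jb-1)
    c∸ja≡ = ℕP.+-cancelˡ-≡ ja _ _ (trans (ℕP.m+[n∸m]≡n ja≤c)
      (sym (trans (sym (ℕP.+-assoc ja d₁ (c ∸ jb-1)))
        (trans (cong (ℕ._+ (c ∸ jb-1)) ja+d₁≡) (ℕP.m+[n∸m]≡n (ℕP.<⇒≤ jb≤c))))))
    shift₁ : ∀ j i → (j - i) + + 1 ≡ (+ 1 + j) - i
    shift₁ = solve-∀
    shift₂ : ∀ j i e → ((+ 1 + j) - i) + e ≡ (+ 1 + (j + e)) - i
    shift₂ = solve-∀
    slide : evalWord k (segment E ib ja d₁) (v + + 1) ≡ + jb - + ib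
    slide = trans (segment-slide E ib ja d₁ (v + + 1) E-row₂-interior (cong (res k) (shift₁ (+ ja) (+ ib))))
      (trans (cong (_+ + d₁) (shift₁ (+ ja) (+ ib)))
        (trans (shift₂ (+ ja) (+ ib) (+ d₁)) (cong (λ z → + suc z - + ib) ja+d₁≡)))
    right-of-xb : ∀ q → jb-1 < q → q ≤ c → E ib q ≡ true → Avoids (+ jb - + ib) ib q
    right-of-xb q jb-1<q q≤c Eq with q ℕP.≟ jb
    ... | yes refl = ⊥-elim (subst T (trans (sym Eq) E-xb) _)
    ... | no q≢jb  = avoids-above (+ jb - + ib) jb ib ib q refl
                       (ℕP.+-monoˡ-< ib (ℕP.≤∧≢⇒< jb-1<q (q≢jb ∘ sym)))
                       (within-period q jb ib (ℕP.≤-trans q≤c c≤k) (s≤s z≤n))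

  -- Column j of the rows strictly between ib and ia lies inside the rectangle.
  between-down : ∀ j z → ja ≤ j → j ≤ jb → res k z ≡ res k (+ j - + ib) → evalWord k between z ≡ z - + d
  between-down j z ja≤j j≤jb z≡ =
    block-down 1≤k E c ib d j z (ℕP.≤-trans (s≤s z≤n) ja≤j) (ℕP.≤-trans j≤jb jb≤c) c≤k column z≡
    where
    column : ∀ p → ib < p → p ≤ ib ℕ.+ d → E p j ≡ true
    column p ib<p p≤ = E-rectangle p j (ℕP.<⇒≤ ib<p , ℕP.<⇒≤ p<ia , ja≤j , j≤jb)
      (≢-row (ℕP.<⇒≢ p<ia)) (≢-row (ℕP.>⇒≢ ib<p)) (≢-row (ℕP.<⇒≢ p<ia)) (≢-row (ℕP.>⇒≢ ib<p))
      where p<ia = row-between p p≤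

  across-between : ∀ j → + j - + ib - + d ≡ + suc j - + ia
  across-between j =
    trans (cong (λ z → + j - + ib - z) (+[m∸n]≡+m-+n ib≤ia-1)) (shift (+ j) (+ ib) (+ ia-1))
    where
    shift : ∀ j i i' → (j - i) - (i' - i) ≡ (+ 1 + j) - (+ 1 + i')
    shift = solve-∀

  leftOf₁-slides : evalWord k leftOf₁ (+ suc ja - + ia) ≡ u
  leftOf₁-slides = begin
    evalWord k leftOf₁ y₀
      ≡⟨ cong (λ l → evalWord k l y₀) (trans (cong (segment E ia 0) (sym ja+d₁≡)) (segment-++ E ia 0 ja d₁)) ⟩
    evalWord k (segment E ia ja d₁ ++ segment E ia 0 ja) y₀
      ≡⟨ eval-++ (segment E ia ja d₁) _ y₀ ⟩
    evalWord k (segment E ia ja d₁) (evalWord k (segment E ia 0 ja) y₀)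
      ≡⟨ cong (evalWord k (segment E ia ja d₁)) (segment-fix E ia 0 ja y₀ left-of-xa) ⟩
    evalWord k (segment E ia ja d₁) y₀
      ≡⟨ segment-slide E ia ja d₁ y₀ E-row₁-interior refl ⟩
    y₀ + + d₁
      ≡⟨ trans (shift (+ ja) (+ ia) (+ d₁)) (cong (λ z → + suc z - + ia) ja+d₁≡) ⟩
    u ∎
    where
    open ≡-Reasoning
    y₀ = + suc ja - + ia
    shift : ∀ j i e → ((+ 1 + j) - i) + e ≡ (+ 1 + (j + e)) - i
    shift = solve-∀
    left-of-xa : ∀ q → 0 < q → q ≤ ja → E ia q ≡ true → Avoids y₀ ia q
    left-of-xa q 0<q q≤ja Eq with q ℕP.≟ ja
    ... | yes refl = ⊥-elim (subst T (trans (sym Eq) E-xa) _)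
    ... | no q≢ja  = avoids-below y₀ (suc ja) ia ia q refl
                       (ℕP.+-monoˡ-< ia (s≤s (ℕP.≤∧≢⇒< q≤ja q≢ja)))
                       (within-period ja q ia (ℕP.≤-trans ja≤c c≤k) 0<q)

  leftOf₁-fixes : evalWord k leftOf₁ (+ suc jb - + ia) ≡ + suc jb - + ia
  leftOf₁-fixes = segment-fix E ia 0 jb-1 (+ suc jb - + ia) (λ q 0<q q≤ _ →
    avoids-below (+ suc jb - + ia) (suc jb) ia ia q refl (ℕP.+-monoˡ-< ia (s≤s (s≤s q≤)))
      (within-period jb q ia (ℕP.≤-trans jb≤c c≤k) 0<q))

  eval-inner : ∀ z → evalWord k inner z ≡ evalWord k leftOf₁ (evalWord k between (evalWord k rightOf₂ z))
  eval-inner z = trans (eval-++ leftOf₁ _ z) (cong (evalWord k leftOf₁) (eval-++ between rightOf₂ z))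

  inner-v : evalWord k inner v ≡ u
  inner-v = begin
    evalWord k inner v
      ≡⟨ eval-inner v ⟩
    evalWord k leftOf₁ (evalWord k between (evalWord k rightOf₂ v))
      ≡⟨ cong (λ z → evalWord k leftOf₁ (evalWord k between z)) rightOf₂-fixes-v ⟩
    evalWord k leftOf₁ (evalWord k between v)
      ≡⟨ cong (evalWord k leftOf₁)
           (trans (between-down ja v ℕP.≤-refl (ℕP.<⇒≤ ja<jb) refl) (across-between ja)) ⟩
    evalWord k leftOf₁ (+ suc ja - + ia)
      ≡⟨ leftOf₁-slides ⟩
    u ∎
    where open ≡-Reasoning

  inner-v+1 : evalWord k inner (v + + 1) ≡ u + + 1
  inner-v+1 = begin
    evalWord k inner (v + + 1)
      ≡⟨ eval-inner (v + + 1) ⟩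
    evalWord k leftOf₁ (evalWord k between (evalWord k rightOf₂ (v + + 1)))
      ≡⟨ cong (λ z → evalWord k leftOf₁ (evalWord k between z)) rightOf₂-slides-v+1 ⟩
    evalWord k leftOf₁ (evalWord k between (+ jb - + ib))
      ≡⟨ cong (evalWord k leftOf₁)
           (trans (between-down jb (+ jb - + ib) (ℕP.<⇒≤ ja<jb) ℕP.≤-refl refl) (across-between jb)) ⟩
    evalWord k leftOf₁ (+ suc jb - + ia)
      ≡⟨ leftOf₁-fixes ⟩
    + suc jb - + ia
      ≡⟨ shift (+ jb) (+ ia) ⟩
    u + + 1 ∎
    where
    open ≡-Reasoning
    shift : ∀ j i → (+ 1 + j) - i ≡ (j - i) + + 1
    shift = solve-∀

  word-D≐word-E : evalWord k (diagWord k D rows c) ≐ evalWord k (diagWord k E rows c)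
  word-D≐word-E m = begin
    evalWord k (diagWord k D rows c) m
      ≡⟨ cong (λ l → evalWord k l m) word-D ⟩
    evalWord k ((below ++ rightOf₁) ++ x ∷ inner ++ y ∷ leftOf₂ ++ above) m
      ≡⟨ eval-cancel-pair (below ++ rightOf₁) x inner y (leftOf₂ ++ above)
           (s-conjugate inner v u inner-v inner-v+1) m ⟩
    evalWord k ((below ++ rightOf₁) ++ inner ++ leftOf₂ ++ above) m
      ≡⟨ cong (λ l → evalWord k l m) (sym word-E) ⟩
    evalWord k (diagWord k E rows c) m ∎
    where open ≡-Reasoning

  length-word-D : length (diagWord k D rows c) ≡ suc (suc (length (diagWord k E rows c)))
  length-word-D = begin
    length (diagWord k D rows c)
      ≡⟨ cong length word-D ⟩
    length ((below ++ rightOf₁) ++ x ∷ inner ++ y ∷ leftOf₂ ++ above)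
      ≡⟨ length-cancel-pair (below ++ rightOf₁) inner (leftOf₂ ++ above) x y ⟩
    suc (suc (length ((below ++ rightOf₁) ++ inner ++ leftOf₂ ++ above)))
      ≡⟨ cong (λ l → suc (suc (length l))) (sym word-E) ⟩
    suc (suc (length (diagWord k E rows c))) ∎
    where open ≡-Reasoning

open import Data.Nat using (_+_)

lemma4p14 : (k c : ℕ) → 1 ≤ k → c ≤ k →
    (lam : ℕ → ℕ) → IsPartitionIn k c lam →
    (n : ℕ) → (X : List Cell) → Unique X → length X ≡ n → All (InShape lam) X →
    (ia ja ib jb : ℕ) → (ia , ja) ∈ X → (ib , jb) ∈ X →
    ib < ia → ja < jb → InShape lam (ia , jb) →
    (∀ x → x ∈ X → x ≢ (ia , ja) → x ≢ (ib , jb) → ¬ InRect (ia , ja) (ib , jb) x) →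
    (Σ ℕ λ a → Σ ℕ λ b →
       Len k (wShape k c lam) a × Len k (wShapeMinus k c lam X) b × b + n < a)
    × ¬ StrongStrip k (wShape k c lam) (wShapeMinus k c lam X) n
lemma4p14 k c 1≤k c≤k lam partition n X unique |X|≡n inλ
          (suc ia-1) (suc ja-1) (suc ib-1) (suc jb-1) xa∈X xb∈X ib<ia ja<jb corner∈λ rect-free =
  (a , b , La , Lb , b+n<a) , no-StrongStrip (wShape k c lam) (wShapeMinus k c lam X) n a b La Lb b+n<a
  where
  open Potential k
  open LengthFunction k
  open Shape k c c≤k lam partition
  open Deletion k c 1≤k c≤k lam partition X ia-1 ja-1 ib-1 jb-1 xa∈X xb∈X ib<ia ja<jb corner∈λ rect-free
  a = proj₁ (Len-exists shapeWord)
  La = proj₂ (Len-exists shapeWord)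
  b = proj₁ (Len-exists (diagWord k D rows c))
  Lb = proj₂ (Len-exists (diagWord k D rows c))
  shapeWord≤a : length shapeWord ≤ a
  shapeWord≤a = ℕP.≤-trans (ℕP.≤-reflexive length-shapeWord)
                  (ℕP.≤-trans size≤potential (potential≤Len 1≤k (wShape k c lam) a La))
  b≤word-E : b ≤ length (diagWord k E rows c)
  b≤word-E = proj₂ Lb (diagWord k E rows c) (λ m → sym (word-D≐word-E m))
  shapeWord≡ : length shapeWord ≡ suc (suc (length (diagWord k E rows c))) + n
  shapeWord≡ = trans (length-minus X unique inλ) (cong₂ _+_ length-word-D |X|≡n)
  b+n<a : b + n < a
  b+n<a = ℕP.<-≤-trans (ℕP.+-monoˡ-< n (s≤s (ℕP.m≤n⇒m≤1+n b≤word-E)))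
            (ℕP.≤-trans (ℕP.≤-reflexive (sym shapeWord≡)) shapeWord≤a)
lemma4p14 _ _ _ _ _ _ _ _ _ _ inλ _ zero _ _ xa∈X _ _ _ _ _ with All.lookup inλ xa∈X
... | _ , () , _
lemma4p14 _ _ _ _ _ _ _ _ _ _ inλ _ _ zero _ _ xb∈X _ _ _ _ with All.lookup inλ xb∈X
... | () , _
lemma4p14 _ _ _ _ _ _ _ _ _ _ _ zero (suc _) (suc _) _ _ _ () _ _ _
lemma4p14 _ _ _ _ _ _ _ _ _ _ _ (suc _) (suc _) (suc _) zero _ _ _ () _ _
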